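{- Let $S$ be a starlike tree with central vertex $v_0$ and $\ell$ leaves $v_1,v_2,\dots,v_\ell$. If $(\mathbf{d},\mathbf{r})$ is an arithmetical structure on $S$, then \[\mathcal{K}(S;\mathbf{d},\mathbf{r})\oplus(\mathbb{Z}/r_0\mathbb{Z})^2\cong\bigoplus_{i=1}^\ell\mathbb{Z}/d^*_i\mathbb{Z},\] where $r_0=\mathbf{r}(v_0)$, $r_i=\mathbf{r}(v_i)$ and $d^*_i=r_0/r_i$.
   Context: A starlike tree is a tree with exactly one vertex of degree at least $3$ (its central vertex). An arithmetical structure on $S$ is a pair $(\mathbf{d},\mathbf{r})$ with $\mathbf{d}\in\mathbb{Z}_{\ge0}^{V(S)}$, $\mathbf{r}\in\mathbb{Z}_{>0}^{V(S)}$ whose entries have no nontrivial common factor, and $(\operatorname{diag}(\mathbf{d})-A(S))\mathbf{r}=\mathbf{0}$, where $A(S)$ is the adjacency matrix. The critical group $\mathcal{K}(S;\mathbf{d},\mathbf{r})$ is the torsion subgroup of $\mathbb{Z}^{V(S)}/\operatorname{im}(\operatorname{diag}(\mathbf{d})-A(S))$. -}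

module Defs where

open import Level using (0ℓ)
open import Data.Nat as ℕ using (ℕ; zero; suc; _≡ᵇ_; NonZero)
open import Data.Nat.Divisibility as ℕD using ()
open import Data.Nat.DivMod using (_/_)
open import Data.Integer as ℤ using (ℤ; +_; 0ℤ; 1ℤ; _+_; _*_; _-_; -_)
open import Data.Integer.Properties using (pos-*)
open import Data.Integer.Divisibility as ℤD using ()
open import Data.Integer.Solver renaming (module +-*-Solver to ℤ-solver)
open import Data.Fin using (Fin; toℕ; fromℕ)
import Data.Fin as Fin
open import Data.Bool using (Bool; true; false; _∧_; _∨_; if_then_else_)
open import Data.Product using (Σ; ∃; _×_; _,_; proj₁; proj₂)
open import Relation.Binary.PropositionalEquality
open import Algebra.Bundles.Raw using (RawGroup)
open import Algebra.Morphism.Structures using (module GroupMorphisms)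

∑ : (n : ℕ) → (Fin n → ℤ) → ℤ
∑ zero    f = 0ℤ
∑ (suc n) f = f Fin.zero + ∑ n (λ i → f (Fin.suc i))

-- The starlike tree S(ℓ; k) with central vertex `center` and ℓ legs;
-- leg i is the path  center — node i 0 — node i 1 — … — node i (k i),
-- i.e. leg i has (suc (k i)) vertices, its leaf being node i (k i).
-- (It is a starlike tree exactly when 3 ≤ ℓ; every starlike tree is
-- isomorphic to one of these.)

data Vtx (ℓ : ℕ) (k : Fin ℓ → ℕ) : Set where
  center : Vtx ℓ k
  node   : (i : Fin ℓ) → Fin (suc (k i)) → Vtx ℓ k

module _ {ℓ : ℕ} {k : Fin ℓ → ℕ} where

  leaf : Fin ℓ → Vtx ℓ k
  leaf i = node i (fromℕ (k i))

  sumV : (Vtx ℓ k → ℤ) → ℤ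
  sumV f = f center + ∑ ℓ (λ i → ∑ (suc (k i)) (λ j → f (node i j)))

  adjB : Vtx ℓ k → Vtx ℓ k → Bool
  adjB center     center       = false
  adjB center     (node i j)   = toℕ j ≡ᵇ 0
  adjB (node i j) center       = toℕ j ≡ᵇ 0
  adjB (node i j) (node i′ j′) =
    (toℕ i ≡ᵇ toℕ i′) ∧ ((suc (toℕ j) ≡ᵇ toℕ j′) ∨ (suc (toℕ j′) ≡ᵇ toℕ j))

  A : Vtx ℓ k → Vtx ℓ k → ℤ
  A u v = if adjB u v then 1ℤ else 0ℤ

  Lap : (Vtx ℓ k → ℕ) → (Vtx ℓ k → ℤ) → Vtx ℓ k → ℤ
  Lap d y v = (+ d v) * y v - sumV (λ u → A v u * y u)

  IsArithmeticalStructure : (Vtx ℓ k → ℕ) → (Vtx ℓ k → ℕ) → Set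
  IsArithmeticalStructure d r =
    (∀ v → NonZero (r v))
    × (∀ m → (∀ v → m ℕD.∣ r v) → m ≡ 1)
    × (∀ v → Lap d (λ u → + r u) v ≡ 0ℤ)

  InImage : (Vtx ℓ k → ℕ) → (Vtx ℓ k → ℤ) → Set
  InImage d x = ∃ λ a → ∀ v → x v ≡ Lap d a v

  IsTorsion : (Vtx ℓ k → ℕ) → (Vtx ℓ k → ℤ) → Set
  IsTorsion d x = ∃ λ m → InImage d (λ v → + suc m * x v)

  private
    ∑-lin : ∀ n (c c′ : ℤ) (f g : Fin n → ℤ) →
            ∑ n (λ i → c * f i + c′ * g i) ≡ c * ∑ n f + c′ * ∑ n g
    ∑-lin zero c c′ f g = solve 2 (λ c c′ → con 0ℤ := c :* con 0ℤ :+ c′ :* con 0ℤ) refl c c′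
      where open ℤ-solver
    ∑-lin (suc n) c c′ f g =
      trans (cong (λ t → c * f Fin.zero + c′ * g Fin.zero + t)
                  (∑-lin n c c′ (λ i → f (Fin.suc i)) (λ i → g (Fin.suc i))))
            (solve 6 (λ c c′ a b s t → (c :* a :+ c′ :* b) :+ (c :* s :+ c′ :* t)
                                      := c :* (a :+ s) :+ c′ :* (b :+ t))
                   refl c c′ (f Fin.zero) (g Fin.zero) (∑ n (λ i → f (Fin.suc i)))
                   (∑ n (λ i → g (Fin.suc i))))
      where open ℤ-solver

    ∑-cong : ∀ n (f g : Fin n → ℤ) → (∀ i → f i ≡ g i) → ∑ n f ≡ ∑ n g
    ∑-cong zero f g e = refl
    ∑-cong (suc n) f g e =
      cong₂ _+_ (e Fin.zero) (∑-cong n (λ i → f (Fin.suc i)) (λ i → g (Fin.suc i)) (λ i → e (Fin.suc i)))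

    sumV-lin : (c c′ : ℤ) (f g : Vtx ℓ k → ℤ) →
               sumV (λ u → c * f u + c′ * g u) ≡ c * sumV f + c′ * sumV g
    sumV-lin c c′ f g =
      trans (cong (λ t → c * f center + c′ * g center + t)
              (trans (∑-cong ℓ _ _ (λ i → ∑-lin (suc (k i)) c c′ (λ j → f (node i j)) (λ j → g (node i j))))
                     (∑-lin ℓ c c′ _ _)))
            (solve 6 (λ c c′ a b s t → (c :* a :+ c′ :* b) :+ (c :* s :+ c′ :* t)
                                      := c :* (a :+ s) :+ c′ :* (b :+ t))
                   refl c c′ (f center) (g center) _ _)
      where open ℤ-solver

    sumV-cong : (f g : Vtx ℓ k → ℤ) → (∀ u → f u ≡ g u) → sumV f ≡ sumV g
    sumV-cong f g e = cong₂ _+_ (e center)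
      (∑-cong ℓ _ _ (λ i → ∑-cong (suc (k i)) _ _ (λ j → e (node i j))))

  Lap-lin : (d : Vtx ℓ k → ℕ) (c c′ : ℤ) (a b : Vtx ℓ k → ℤ) (v : Vtx ℓ k) →
            Lap d (λ u → c * a u + c′ * b u) v ≡ c * Lap d a v + c′ * Lap d b v
  Lap-lin d c c′ a b v =
    trans (cong (λ t → (+ d v) * (c * a v + c′ * b v) - t)
            (trans (sumV-cong (λ u → A v u * (c * a u + c′ * b u)) (λ u → c * (A v u * a u) + c′ * (A v u * b u)) (λ u → solve 5 (λ x c c′ p q → x :* (c :* p :+ c′ :* q)
                                                    := c :* (x :* p) :+ c′ :* (x :* q))
                                              refl (A v u) c c′ (a u) (b u)))
                   (sumV-lin c c′ (λ u → A v u * a u) (λ u → A v u * b u))))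
          (solve 7 (λ D c c′ p q s t → D :* (c :* p :+ c′ :* q) :- (c :* s :+ c′ :* t)
                                       := c :* (D :* p :- s) :+ c′ :* (D :* q :- t))
                 refl (+ d v) c c′ (a v) (b v) (sumV (λ u → A v u * a u)) (sumV (λ u → A v u * b u)))
    where open ℤ-solver

  -- The critical group K(S; d, r): the torsion subgroup of
  -- ℤ^V / im(diag(d) − A(S)), as a raw group on a setoid
  -- (elements: torsion integer vectors; equality: difference in the image).

  criticalGroup : (Vtx ℓ k → ℕ) → RawGroup 0ℓ 0ℓ
  criticalGroup d = record
    { Carrier = Σ (Vtx ℓ k → ℤ) (IsTorsion d)
    ; _≈_     = λ x y → InImage d (λ v → proj₁ x v - proj₁ y v)
    ; _∙_     = λ x y → (λ v → proj₁ x v + proj₁ y v) , add x y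
    ; ε       = (λ v → 0ℤ) , (0 , (λ v → 0ℤ) , λ v →
                  trans (solve 0 (con 1ℤ :* con 0ℤ := con 0ℤ :* con 0ℤ :+ con 0ℤ :* con 0ℤ) refl)
                        (sym (Lap-lin d 0ℤ 0ℤ (λ _ → 0ℤ) (λ _ → 0ℤ) v)))
    ; _⁻¹     = λ x → (λ v → - proj₁ x v) , neg x
    }
    where
    open ℤ-solver
    add : (x y : Σ (Vtx ℓ k → ℤ) (IsTorsion d)) → IsTorsion d (λ v → proj₁ x v + proj₁ y v)
    add (x , m₁ , a , ea) (y , m₂ , b , eb) =
      (m₂ ℕ.+ m₁ ℕ.* suc m₂) , (λ u → + suc m₂ * a u + + suc m₁ * b u) , λ v →
        trans (cong (_* (x v + y v)) (pos-* (suc m₁) (suc m₂)))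
        (trans (solve 4 (λ s t p q → (s :* t) :* (p :+ q) := t :* (s :* p) :+ s :* (t :* q))
                       refl (+ suc m₁) (+ suc m₂) (x v) (y v))
        (trans (cong₂ (λ P Q → + suc m₂ * P + + suc m₁ * Q) (ea v) (eb v))
               (sym (Lap-lin d (+ suc m₂) (+ suc m₁) a b v))))
    neg : (x : Σ (Vtx ℓ k → ℤ) (IsTorsion d)) → IsTorsion d (λ v → - proj₁ x v)
    neg (x , m , a , ea) =
      m , (λ u → - 1ℤ * a u + 0ℤ * a u) , λ v →
        trans (solve 3 (λ s p L → s :* (:- p) := (:- con 1ℤ) :* (s :* p) :+ con 0ℤ :* L)
                      refl (+ suc m) (x v) (Lap d a v))
        (trans (cong (λ P → - 1ℤ * P + 0ℤ * Lap d a v) (ea v))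
               (sym (Lap-lin d (- 1ℤ) 0ℤ a a v)))

ℤmod : ℕ → RawGroup 0ℓ 0ℓ
ℤmod n = record
  { Carrier = ℤ
  ; _≈_     = λ x y → (+ n) ℤD.∣ (x - y)
  ; _∙_     = _+_
  ; ε       = 0ℤ
  ; _⁻¹     = -_
  }

⨁ℤmod : (n : ℕ) → (Fin n → ℕ) → RawGroup 0ℓ 0ℓ
⨁ℤmod n m = record
  { Carrier = Fin n → ℤ
  ; _≈_     = λ x y → ∀ i → (+ m i) ℤD.∣ (x i - y i)
  ; _∙_     = λ x y i → x i + y i
  ; ε       = λ i → 0ℤ
  ; _⁻¹     = λ x i → - x i
  }

_≅_ : RawGroup 0ℓ 0ℓ → RawGroup 0ℓ 0ℓ → Set
G ≅ H = ∃ λ (f : RawGroup.Carrier G → RawGroup.Carrier H) →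
          GroupMorphisms.IsGroupIsomorphism G H f

dStar : {ℓ : ℕ} {k : Fin ℓ → ℕ} (r : Vtx ℓ k → ℕ) →
        (∀ v → NonZero (r v)) → Fin ℓ → ℕ
dStar r nz i = _/_ (r center) (r (leaf i)) {{nz (leaf i)}}

module Submission where

-- Write L = diag(d) − A and w_i for the vector equal to r/r_i on leg i, to d*_i = r₀/r_i at the
-- centre and to 0 elsewhere. As L is symmetric and L w_i is supported on the centre and the first
-- vertices of the legs, ⟨w_i, L a⟩ ≡ −a(centre) u_i (mod d*_i) with u_i = r(first vertex of leg i)/r_i,
-- while ⟨r, L a⟩ = 0. Two Bézout identities, c₀ r₀ + Σ c_i r(first vertex of leg i) = 1 and
-- Σ ξ_i r_i = 1, give functionals χ = Σ c_i r_i (·)_i and ψ = Σ r_i (·)_i from ⊕ ℤ/d*_i to ℤ/r₀,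
-- and vectors u and x̂ = ξ − χ(ξ) u on which they take the values (1, 0) and (0, 1) modulo r₀.
-- With P y = (⟨w_i, y⟩)_i, the map (y, s, t) ↦ P y − χ(P y) u + s u + t x̂ is the isomorphism.
-- Injectivity and surjectivity both rest on solving the recurrence of L along the legs, which moves
-- any vector, modulo im L, to one supported on the leaves, where P can be read off.

open import Defs
open import Data.Nat using (ℕ; _≤_; zero; suc; NonZero; _<_; _≡ᵇ_; _<ᵇ_; s≤s; z≤n)
open import Data.Fin using (Fin; zero; suc; toℕ; fromℕ)
open import Data.Product using (proj₁; proj₂; _,_; Σ; _×_)
open import Algebra.Construct.DirectProduct using (rawGroup)

open import Level using (0ℓ)
open import Function using (_∘_)
open import Function.Bundles using (Equivalence)
open import Data.Sum using (inj₁; inj₂)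
open import Data.Bool using (Bool; true; false; T; _∧_; _∨_; if_then_else_)
open import Data.Bool.Properties using (∨-comm; T-∧; if-float)
import Data.Nat as ℕ
import Data.Nat.Properties as ℕ
open import Data.Nat.Divisibility
  using (_∣_; ∣-refl; ∣-trans; ∣-reflexive; _∣0; ∣m+n∣m⇒∣n; ∣n⇒∣m*n)
open import Data.Nat.DivMod using (_/_; m*[n/m]≡n; n/n≡1)
open import Data.Nat.GCD using (GCD; module Bézout)
import Data.Fin.Properties as Fin
open import Data.Integer using (ℤ; +_; 0ℤ; 1ℤ; _+_; _*_; _-_; -_)
import Data.Integer.Properties as ℤ
open import Data.Integer.Divisibility using () renaming (_∣_ to _∣ℤ_)
open import Data.Integer.Divisibility.Signed using (divides; ∣⇒∣ᵤ; ∣ᵤ⇒∣)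
open import Data.Integer.Tactic.RingSolver using (solve-∀)
open import Data.Vec.Functional using (map)
open import Algebra.Bundles.Raw using (RawGroup)
open import Algebra.Morphism.Structures using (module GroupMorphisms)
open GroupMorphisms using (IsGroupIsomorphism)
open import Algebra.Properties.CommutativeSemigroup ℤ.+-commutativeSemigroup
  using () renaming (interchange to +-interchange)
open import Algebra.Properties.CommutativeSemigroup ℤ.*-commutativeSemigroup
  using (x∙yz≈y∙xz)
open import Algebra.Properties.Semiring.Sum ℤ.+-*-semiring
  using (sum; *-distribˡ-sum)
  renaming (∑-distrib-+ to sum-distrib-+; ∑-comm to sum-comm)
open import Relation.Binary.Definitions using (tri<; tri≈; tri>)
open import Relation.Binary.PropositionalEquality
open import Relation.Nullary using (¬_; contradiction; yes; no)

∑≡sum : ∀ n (f : Fin n → ℤ) → ∑ n f ≡ sum f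
∑≡sum zero    f = refl
∑≡sum (suc n) f = cong (λ s → f zero + s) (∑≡sum n (λ i → f (suc i)))

∑-cong : ∀ n {f g : Fin n → ℤ} → (∀ i → f i ≡ g i) → ∑ n f ≡ ∑ n g
∑-cong zero    e = refl
∑-cong (suc n) e = cong₂ _+_ (e zero) (∑-cong n (λ i → e (suc i)))

∑-distrib-+ : ∀ n (f g : Fin n → ℤ) → ∑ n (λ i → f i + g i) ≡ ∑ n f + ∑ n g
∑-distrib-+ n f g = begin
  ∑ n (λ i → f i + g i)  ≡⟨ ∑≡sum n _ ⟩
  sum (λ i → f i + g i)  ≡⟨ sum-distrib-+ f g ⟩
  sum f + sum g          ≡⟨ sym (cong₂ _+_ (∑≡sum n f) (∑≡sum n g)) ⟩
  ∑ n f + ∑ n g          ∎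
  where open ≡-Reasoning

*-distribˡ-∑ : ∀ n c (f : Fin n → ℤ) → c * ∑ n f ≡ ∑ n (λ i → c * f i)
*-distribˡ-∑ n c f = begin
  c * ∑ n f                ≡⟨ cong (c *_) (∑≡sum n f) ⟩
  c * sum f                ≡⟨ *-distribˡ-sum c f ⟩
  sum (map (c *_) f)       ≡⟨ sym (∑≡sum n _) ⟩
  ∑ n (λ i → c * f i)      ∎
  where open ≡-Reasoning

∑-comm : ∀ n m (F : Fin n → Fin m → ℤ) →
  ∑ n (λ i → ∑ m (F i)) ≡ ∑ m (λ j → ∑ n (λ i → F i j))
∑-comm n m F = begin
  ∑ n (λ i → ∑ m (F i))            ≡⟨ ∑-cong n (λ i → ∑≡sum m (F i)) ⟩
  ∑ n (λ i → sum (F i))            ≡⟨ ∑≡sum n _ ⟩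
  sum (λ i → sum (F i))            ≡⟨ sum-comm F ⟩
  sum (λ j → sum (λ i → F i j))    ≡⟨ sym (∑≡sum m _) ⟩
  ∑ m (λ j → sum (λ i → F i j))    ≡⟨ sym (∑-cong m (λ j → ∑≡sum n (λ i → F i j))) ⟩
  ∑ m (λ j → ∑ n (λ i → F i j))    ∎
  where open ≡-Reasoning

∑-zero : ∀ n (f : Fin n → ℤ) → (∀ i → f i ≡ 0ℤ) → ∑ n f ≡ 0ℤ
∑-zero zero    f e = refl
∑-zero (suc n) f e = trans (cong₂ _+_ (e zero) (∑-zero n (f ∘ suc) (e ∘ suc))) (ℤ.+-identityʳ 0ℤ)

∑-single : ∀ n (f : Fin n → ℤ) p → (∀ q → ¬ q ≡ p → f q ≡ 0ℤ) → ∑ n f ≡ f p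
∑-single (suc n) f zero h =
  trans (cong (λ s → f zero + s) (∑-zero n (f ∘ suc) (λ q → h (suc q) (λ ()))))
        (ℤ.+-identityʳ _)
∑-single (suc n) f (suc p) h =
  trans (cong₂ _+_ (h zero (λ ()))
                   (∑-single n (λ i → f (suc i)) p (λ q q≢p → h (suc q) (q≢p ∘ Fin.suc-injective))))
        (ℤ.+-identityˡ _)

∑-neg : ∀ n (f : Fin n → ℤ) → ∑ n (λ i → - f i) ≡ - ∑ n f
∑-neg n f = begin
  ∑ n (λ i → - f i)         ≡⟨ ∑-cong n (λ i → sym (ℤ.-1*i≡-i (f i))) ⟩
  ∑ n (λ i → - 1ℤ * f i)    ≡⟨ sym (*-distribˡ-∑ n (- 1ℤ) f) ⟩
  - 1ℤ * ∑ n f              ≡⟨ ℤ.-1*i≡-i _ ⟩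
  - ∑ n f                   ∎
  where open ≡-Reasoning

*-distribʳ-∑ : ∀ n c (f : Fin n → ℤ) → ∑ n f * c ≡ ∑ n (λ i → f i * c)
*-distribʳ-∑ n c f =
  trans (ℤ.*-comm (∑ n f) c) (trans (*-distribˡ-∑ n c f) (∑-cong n (λ i → ℤ.*-comm c (f i))))

∑-sub : ∀ n (f g : Fin n → ℤ) → ∑ n (λ i → f i - g i) ≡ ∑ n f - ∑ n g
∑-sub n f g = trans (∑-distrib-+ n f (λ i → - g i)) (cong (λ s → ∑ n f + s) (∑-neg n g))

∑-const : ∀ n (c : ℤ) → ∑ n (λ _ → c) ≡ + n * c
∑-const zero    c = sym (ℤ.*-zeroˡ c)
∑-const (suc n) c = begin
  c + ∑ n (λ _ → c)   ≡⟨ cong (λ s → c + s) (∑-const n c) ⟩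
  c + + n * c         ≡⟨ cong (_+ + n * c) (sym (ℤ.*-identityˡ c)) ⟩
  1ℤ * c + + n * c    ≡⟨ sym (ℤ.*-distribʳ-+ c 1ℤ (+ n)) ⟩
  + suc n * c         ∎
  where open ≡-Reasoning

record BezoutCombination (n g₀ : ℕ) (f : Fin n → ℕ) : Set where
  field
    g           : ℕ
    c₀          : ℤ
    c           : Fin n → ℤ
    combination : c₀ * + g₀ + ∑ n (λ i → c i * + f i) ≡ + g
    g∣g₀        : g ∣ g₀
    g∣f         : ∀ i → g ∣ f i

bezout₂ : ∀ m n → Σ ℕ λ g → Σ ℤ λ α → Σ ℤ λ β → (α * + m + β * + n ≡ + g) × GCD m n g
bezout₂ m n with Bézout.lemma m n
... | Bézout.result g gcd (Bézout.+- x y g+yn≡xm) = g , + x , - + y , identity , gcd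
  where
  identity : + x * + m + - + y * + n ≡ + g
  identity = begin
    + x * + m + - + y * + n
      ≡⟨ cong (λ s → s + - + y * + n) (trans (sym (ℤ.pos-* x m)) (cong +_ (sym g+yn≡xm))) ⟩
    + (g ℕ.+ y ℕ.* n) + - + y * + n
      ≡⟨ cong (λ s → s + - + y * + n)
              (trans (ℤ.pos-+ g (y ℕ.* n)) (cong (λ s → + g + s) (ℤ.pos-* y n))) ⟩
    + g + + y * + n + - + y * + n
      ≡⟨ cancel (+ g) (+ y) (+ n) ⟩
    + g ∎
    where
    open ≡-Reasoning
    cancel : ∀ g y n → g + y * n + - y * n ≡ g
    cancel = solve-∀
... | Bézout.result g gcd (Bézout.-+ x y g+xm≡yn) = g , - + x , + y , identity , gcd
  where
  identity : - + x * + m + + y * + n ≡ + g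
  identity = begin
    - + x * + m + + y * + n
      ≡⟨ cong (λ s → - + x * + m + s) (trans (sym (ℤ.pos-* y n)) (cong +_ (sym g+xm≡yn))) ⟩
    - + x * + m + + (g ℕ.+ x ℕ.* m)
      ≡⟨ cong (λ s → - + x * + m + s)
              (trans (ℤ.pos-+ g (x ℕ.* m)) (cong (λ s → + g + s) (ℤ.pos-* x m))) ⟩
    - + x * + m + (+ g + + x * + m)
      ≡⟨ cancel (+ g) (+ x) (+ m) ⟩
    + g ∎
    where
    open ≡-Reasoning
    cancel : ∀ g x m → - x * m + (g + x * m) ≡ g
    cancel = solve-∀

bezoutCombination : ∀ n g₀ (f : Fin n → ℕ) → BezoutCombination n g₀ f
bezoutCombination zero g₀ f = record
  { g = g₀ ; c₀ = 1ℤ ; c = λ () ; combination = trans (ℤ.+-identityʳ _) (ℤ.*-identityˡ _)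
  ; g∣g₀ = ∣-refl ; g∣f = λ () }
bezoutCombination (suc n) g₀ f with bezoutCombination n g₀ (f ∘ suc)
... | record { g = g′ ; c₀ = c₀′ ; c = c′ ; combination = comb′
             ; g∣g₀ = g′∣g₀ ; g∣f = g′∣f }
    with bezout₂ g′ (f zero)
... | g , α , β , αg′+βf₀≡g , gcd = record
  { g = g ; c₀ = α * c₀′ ; c = c ; combination = combination
  ; g∣g₀ = ∣-trans (GCD.gcd∣m gcd) g′∣g₀ ; g∣f = g∣f }
  where
  c : Fin (suc n) → ℤ
  c zero    = β
  c (suc i) = α * c′ i
  S : ℤ
  S = ∑ n (λ i → c′ i * + f (suc i))
  combination : α * c₀′ * + g₀ + ∑ (suc n) (λ i → c i * + f i) ≡ + g
  combination = begin
    α * c₀′ * + g₀ + (β * + f zero + ∑ n (λ i → α * c′ i * + f (suc i)))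
      ≡⟨ cong (λ s → α * c₀′ * + g₀ + (β * + f zero + s))
              (trans (∑-cong n (λ i → ℤ.*-assoc α (c′ i) (+ f (suc i)))) (sym (*-distribˡ-∑ n α _))) ⟩
    α * c₀′ * + g₀ + (β * + f zero + α * S)
      ≡⟨ regroup α β c₀′ (+ g₀) (+ f zero) S ⟩
    α * (c₀′ * + g₀ + S) + β * + f zero
      ≡⟨ cong (λ s → α * s + β * + f zero) comb′ ⟩
    α * + g′ + β * + f zero
      ≡⟨ αg′+βf₀≡g ⟩
    + g ∎
    where
    open ≡-Reasoning
    regroup : ∀ α β c₀ g₀ f₀ S →
      α * c₀ * g₀ + (β * f₀ + α * S) ≡ α * (c₀ * g₀ + S) + β * f₀
    regroup = solve-∀
  g∣f : ∀ i → g ∣ f i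
  g∣f zero    = GCD.gcd∣n gcd
  g∣f (suc i) = ∣-trans (GCD.gcd∣m gcd) (g′∣f i)

bezout-coprime : ∀ n g₀ (f : Fin n → ℕ) → (∀ m → m ∣ g₀ → (∀ i → m ∣ f i) → m ≡ 1) →
  Σ ℤ λ c₀ → Σ (Fin n → ℤ) λ c → c₀ * + g₀ + ∑ n (λ i → c i * + f i) ≡ 1ℤ
bezout-coprime n g₀ f coprime =
  c₀ , c , trans combination (cong +_ (coprime g g∣g₀ g∣f))
  where open BezoutCombination (bezoutCombination n g₀ f)

∣ℤ-intro : ∀ m x Q → x ≡ Q * m → m ∣ℤ x
∣ℤ-intro m x Q x≡Qm = ∣⇒∣ᵤ {m} {x} (divides Q x≡Qm)

∣ℤ-elim : ∀ m x → m ∣ℤ x → Σ ℤ λ Q → x ≡ Q * m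
∣ℤ-elim m x m∣x with ∣ᵤ⇒∣ {m} {x} m∣x
... | divides Q x≡Qm = Q , x≡Qm

≡ᵇ-sym : ∀ m n → (m ≡ᵇ n) ≡ (n ≡ᵇ m)
≡ᵇ-sym zero    zero    = refl
≡ᵇ-sym zero    (suc n) = refl
≡ᵇ-sym (suc m) zero    = refl
≡ᵇ-sym (suc m) (suc n) = ≡ᵇ-sym m n

indicator : Bool → ℤ
indicator b = if b then 1ℤ else 0ℤ

indicator-true : ∀ {b} (g : ℤ) → T b → indicator b * g ≡ g
indicator-true {true} g _ = ℤ.*-identityˡ g

indicator-false : ∀ {b} (g : ℤ) → ¬ T b → indicator b * g ≡ 0ℤ
indicator-false {true}  g ¬t = contradiction _ ¬t
indicator-false {false} g _  = refl

indicator-∨ : ∀ a b (g : ℤ) → ¬ T (a ∧ b) → indicator (a ∨ b) * g ≡ indicator a * g + indicator b * g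
indicator-∨ false false g _  = refl
indicator-∨ false true  g _  = sym (ℤ.+-identityˡ _)
indicator-∨ true  false g _  = sym (ℤ.+-identityʳ _)
indicator-∨ true  true  g ¬t = contradiction _ ¬t

≡ᵇ-refl : ∀ n → (n ≡ᵇ n) ≡ true
≡ᵇ-refl zero    = refl
≡ᵇ-refl (suc n) = ≡ᵇ-refl n

if-true : ∀ {X : Set} {b} {x y : X} → T b → (if b then x else y) ≡ x
if-true {b = true} _ = refl

if-false : ∀ {X : Set} {b} {x y : X} → ¬ T b → (if b then x else y) ≡ y
if-false {b = true}  ¬t = contradiction _ ¬t
if-false {b = false} _  = refl

clamp : ∀ {K} → ℕ → Fin (suc K)
clamp {K}     zero    = zero
clamp {zero}  (suc n) = zero
clamp {suc K} (suc n) = suc (clamp {K} n)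

toℕ-clamp : ∀ {K} n → n ≤ K → toℕ (clamp {K} n) ≡ n
toℕ-clamp {K}     zero    _         = refl
toℕ-clamp {suc K} (suc n) (s≤s n≤K) = cong suc (toℕ-clamp n n≤K)

clamp-toℕ : ∀ {K} (j : Fin (suc K)) → clamp (toℕ j) ≡ j
clamp-toℕ {K}     zero    = refl
clamp-toℕ {suc K} (suc j) = cong suc (clamp-toℕ j)

clamp-fromℕ : ∀ K → clamp {K} K ≡ fromℕ K
clamp-fromℕ K = trans (cong clamp (sym (Fin.toℕ-fromℕ K))) (clamp-toℕ (fromℕ K))

∑-indicator : ∀ K m (g : Fin (suc K) → ℤ) → m ≤ K →
  ∑ (suc K) (λ j → indicator (m ≡ᵇ toℕ j) * g j) ≡ g (clamp m)
∑-indicator K m g m≤K = begin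
  ∑ (suc K) (λ j → indicator (m ≡ᵇ toℕ j) * g j)
    ≡⟨ ∑-single (suc K) _ (clamp m) off-m ⟩
  indicator (m ≡ᵇ toℕ (clamp {K} m)) * g (clamp m)
    ≡⟨ indicator-true _ (ℕ.≡⇒≡ᵇ m _ (sym (toℕ-clamp m m≤K))) ⟩
  g (clamp m) ∎
  where
  open ≡-Reasoning
  off-m : ∀ j → ¬ j ≡ clamp m → indicator (m ≡ᵇ toℕ j) * g j ≡ 0ℤ
  off-m j j≢m = indicator-false (g j) (λ t →
    j≢m (trans (sym (clamp-toℕ j)) (cong clamp (sym (ℕ.≡ᵇ⇒≡ m (toℕ j) t)))))

∑-indicator-beyond : ∀ K m (g : Fin (suc K) → ℤ) → K < m →
  ∑ (suc K) (λ j → indicator (m ≡ᵇ toℕ j) * g j) ≡ 0ℤ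
∑-indicator-beyond K m g K<m =
  ∑-zero (suc K) (λ j → indicator (m ≡ᵇ toℕ j) * g j) (λ j → indicator-false (g j) (λ t →
    ℕ.<⇒≢ (ℕ.≤-<-trans (Fin.toℕ≤pred[n] j) K<m) (sym (ℕ.≡ᵇ⇒≡ m (toℕ j) t))))

pred-and-succ-differ : ∀ m n → ¬ T ((suc m ≡ᵇ n) ∧ (suc n ≡ᵇ m))
pred-and-succ-differ m n t with Equivalence.to T-∧ t
... | 1+m≡ᵇn , 1+n≡ᵇm =
  ℕ.m≢1+n+m n {1}
    (sym (trans (cong suc (ℕ.≡ᵇ⇒≡ (suc n) m 1+n≡ᵇm)) (ℕ.≡ᵇ⇒≡ (suc m) n 1+m≡ᵇn)))

module _ {ℓ : ℕ} {k : Fin ℓ → ℕ} where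

  private
    V : Set
    V = Vtx ℓ k

  sumV-cong : {f g : V → ℤ} → (∀ v → f v ≡ g v) → sumV f ≡ sumV g
  sumV-cong e = cong₂ _+_ (e center) (∑-cong ℓ (λ i → ∑-cong (suc (k i)) (λ j → e (node i j))))

  sumV-distrib-+ : (f g : V → ℤ) → sumV (λ v → f v + g v) ≡ sumV f + sumV g
  sumV-distrib-+ f g =
    trans (cong (λ s → (f center + g center) + s)
                (trans (∑-cong ℓ (λ i → ∑-distrib-+ (suc (k i)) (f ∘ node i) (g ∘ node i)))
                       (∑-distrib-+ ℓ _ _)))
          (+-interchange (f center) (g center) _ _)

  *-distribˡ-sumV : (c : ℤ) (f : V → ℤ) → c * sumV f ≡ sumV (λ v → c * f v)
  *-distribˡ-sumV c f =
    trans (ℤ.*-distribˡ-+ c (f center) _)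
          (cong (λ s → c * f center + s)
                (trans (*-distribˡ-∑ ℓ c _)
                       (∑-cong ℓ (λ i → *-distribˡ-∑ (suc (k i)) c (f ∘ node i)))))

  *-distribʳ-sumV : (c : ℤ) (f : V → ℤ) → sumV f * c ≡ sumV (λ v → f v * c)
  *-distribʳ-sumV c f =
    trans (ℤ.*-comm (sumV f) c)
          (trans (*-distribˡ-sumV c f) (sumV-cong (λ v → ℤ.*-comm c (f v))))

  sumV-neg : (f : V → ℤ) → sumV (λ v → - f v) ≡ - sumV f
  sumV-neg f = begin
    sumV (λ v → - f v)         ≡⟨ sumV-cong (λ v → sym (ℤ.-1*i≡-i (f v))) ⟩
    sumV (λ v → - 1ℤ * f v)    ≡⟨ sym (*-distribˡ-sumV (- 1ℤ) f) ⟩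
    - 1ℤ * sumV f              ≡⟨ ℤ.-1*i≡-i _ ⟩
    - sumV f                   ∎
    where open ≡-Reasoning

  sumV-sub : (f g : V → ℤ) → sumV (λ v → f v - g v) ≡ sumV f - sumV g
  sumV-sub f g = trans (sumV-distrib-+ f (λ v → - g v)) (cong (λ s → sumV f + s) (sumV-neg g))

  sumV-∑-comm : ∀ n (G : V → Fin n → ℤ) →
    sumV (λ v → ∑ n (G v)) ≡ ∑ n (λ i → sumV (λ v → G v i))
  sumV-∑-comm n G =
    trans (cong (λ s → ∑ n (G center) + s)
                (trans (∑-cong ℓ (λ i → ∑-comm (suc (k i)) n (G ∘ node i))) (∑-comm ℓ n _)))
          (sym (∑-distrib-+ n (G center) _))

  sumV-comm : (G : V → V → ℤ) → sumV (λ v → sumV (G v)) ≡ sumV (λ u → sumV (λ v → G v u))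
  sumV-comm G =
    trans (sumV-distrib-+ (λ v → G v center) (λ v → ∑ ℓ (λ i → ∑ (suc (k i)) (G v ∘ node i))))
          (cong (λ s → sumV (λ v → G v center) + s)
                (trans (sumV-∑-comm ℓ (λ v i → ∑ (suc (k i)) (G v ∘ node i)))
                       (∑-cong ℓ (λ i → sumV-∑-comm (suc (k i)) (λ v → G v ∘ node i)))))

  sumV-center : (f : V → ℤ) → (∀ i j → f (node i j) ≡ 0ℤ) → sumV f ≡ f center
  sumV-center f h =
    trans (cong (λ s → f center + s) (∑-zero ℓ _ (λ i → ∑-zero (suc (k i)) (f ∘ node i) (h i))))
          (ℤ.+-identityʳ _)

  sumV-zero : (f : V → ℤ) → (∀ v → f v ≡ 0ℤ) → sumV f ≡ 0ℤ
  sumV-zero f h = trans (sumV-center f (λ i j → h (node i j))) (h center)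

  infix 4 ⟨_,_⟩

  ⟨_,_⟩ : (V → ℤ) → (V → ℤ) → ℤ
  ⟨ x , y ⟩ = sumV (λ v → x v * y v)

  ⟨⟩-comm : (x y : V → ℤ) → ⟨ x , y ⟩ ≡ ⟨ y , x ⟩
  ⟨⟩-comm x y = sumV-cong (λ v → ℤ.*-comm (x v) (y v))

  ⟨⟩-congʳ : (g : V → ℤ) {a b : V → ℤ} → (∀ v → a v ≡ b v) → ⟨ g , a ⟩ ≡ ⟨ g , b ⟩
  ⟨⟩-congʳ g e = sumV-cong (λ v → cong (g v *_) (e v))

  ⟨⟩-linearʳ : (g : V → ℤ) (c : ℤ) (a : V → ℤ) (c′ : ℤ) (b : V → ℤ) →
    ⟨ g , (λ v → c * a v + c′ * b v) ⟩ ≡ c * ⟨ g , a ⟩ + c′ * ⟨ g , b ⟩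
  ⟨⟩-linearʳ g c a c′ b = begin
    ⟨ g , (λ v → c * a v + c′ * b v) ⟩
      ≡⟨ sumV-cong (λ v → distribute (g v) c (a v) c′ (b v)) ⟩
    sumV (λ v → c * (g v * a v) + c′ * (g v * b v))
      ≡⟨ sumV-distrib-+ (λ v → c * (g v * a v)) (λ v → c′ * (g v * b v)) ⟩
    sumV (λ v → c * (g v * a v)) + sumV (λ v → c′ * (g v * b v))
      ≡⟨ sym (cong₂ _+_ (*-distribˡ-sumV c (λ v → g v * a v))
                        (*-distribˡ-sumV c′ (λ v → g v * b v))) ⟩
    c * ⟨ g , a ⟩ + c′ * ⟨ g , b ⟩ ∎
    where
    open ≡-Reasoning
    distribute : ∀ x c p c′ q → x * (c * p + c′ * q) ≡ c * (x * p) + c′ * (x * q)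
    distribute = solve-∀

  ⟨⟩-scaleʳ : (g : V → ℤ) (c : ℤ) (a : V → ℤ) → ⟨ g , (λ v → c * a v) ⟩ ≡ c * ⟨ g , a ⟩
  ⟨⟩-scaleʳ g c a =
    trans (sumV-cong (λ v → x∙yz≈y∙xz (g v) c (a v))) (sym (*-distribˡ-sumV c (λ v → g v * a v)))

  ⟨⟩-subʳ : (g a b : V → ℤ) → ⟨ g , (λ v → a v - b v) ⟩ ≡ ⟨ g , a ⟩ - ⟨ g , b ⟩
  ⟨⟩-subʳ g a b =
    trans (sumV-cong (λ v → distribute (g v) (a v) (b v)))
          (sumV-sub (λ v → g v * a v) (λ v → g v * b v))
    where
    distribute : ∀ x p q → x * (p - q) ≡ x * p - x * q
    distribute = solve-∀

module _ {ℓ : ℕ} {k : Fin ℓ → ℕ} where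

  private
    V : Set
    V = Vtx ℓ k

  adjB-sym : (u v : V) → adjB u v ≡ adjB v u
  adjB-sym center     center       = refl
  adjB-sym center     (node i j)   = refl
  adjB-sym (node i j) center       = refl
  adjB-sym (node i j) (node i′ j′) =
    cong₂ _∧_ (≡ᵇ-sym (toℕ i) (toℕ i′))
              (∨-comm (suc (toℕ j) ≡ᵇ toℕ j′) (suc (toℕ j′) ≡ᵇ toℕ j))

  A-sym : (u v : V) → A u v ≡ A v u
  A-sym u v = cong (λ b → if b then 1ℤ else 0ℤ) (adjB-sym u v)

  neighbourSum : (V → ℤ) → V → ℤ
  neighbourSum y v = sumV (λ u → A v u * y u)

  neighbourSum-selfAdjoint : (w a : V → ℤ) → ⟨ w , neighbourSum a ⟩ ≡ ⟨ neighbourSum w , a ⟩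
  neighbourSum-selfAdjoint w a = begin
    ⟨ w , neighbourSum a ⟩
      ≡⟨ sumV-cong (λ v → *-distribˡ-sumV (w v) (λ u → A v u * a u)) ⟩
    sumV (λ v → sumV (λ u → w v * (A v u * a u)))
      ≡⟨ sumV-comm (λ v u → w v * (A v u * a u)) ⟩
    sumV (λ u → sumV (λ v → w v * (A v u * a u)))
      ≡⟨ sumV-cong (λ u → sumV-cong (λ v →
           trans (regroup (w v) (A v u) (a u)) (cong (λ x → x * w v * a u) (A-sym v u)))) ⟩
    sumV (λ u → sumV (λ v → A u v * w v * a u))
      ≡⟨ sumV-cong (λ u → sym (*-distribʳ-sumV (a u) (λ v → A u v * w v))) ⟩
    ⟨ neighbourSum w , a ⟩ ∎
    where
    open ≡-Reasoning
    regroup : ∀ x y z → x * (y * z) ≡ y * x * z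
    regroup = solve-∀

  Lap-selfAdjoint : (d : V → ℕ) (w a : V → ℤ) → ⟨ w , Lap d a ⟩ ≡ ⟨ Lap d w , a ⟩
  Lap-selfAdjoint d w a = begin
    ⟨ w , Lap d a ⟩
      ≡⟨ ⟨⟩-subʳ w (λ v → + d v * a v) (neighbourSum a) ⟩
    ⟨ w , (λ v → + d v * a v) ⟩ - ⟨ w , neighbourSum a ⟩
      ≡⟨ cong₂ _-_ (sumV-cong (λ v → regroup (w v) (+ d v) (a v)))
                   (trans (neighbourSum-selfAdjoint w a) (⟨⟩-comm (neighbourSum w) a)) ⟩
    ⟨ a , (λ v → + d v * w v) ⟩ - ⟨ a , neighbourSum w ⟩
      ≡⟨ sym (⟨⟩-subʳ a (λ v → + d v * w v) (neighbourSum w)) ⟩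
    ⟨ a , Lap d w ⟩
      ≡⟨ ⟨⟩-comm a (Lap d w) ⟩
    ⟨ Lap d w , a ⟩ ∎
    where
    open ≡-Reasoning
    regroup : ∀ x y z → x * (y * z) ≡ z * (y * x)
    regroup = solve-∀

-- The Laplacian along the legs

module _ {ℓ : ℕ} {k : Fin ℓ → ℕ} where

  private
    V : Set
    V = Vtx ℓ k

  legNode : Fin ℓ → ℕ → V
  legNode i n = node i (clamp n)

  prev : (V → ℤ) → Fin ℓ → ℕ → ℤ
  prev y i zero    = y center
  prev y i (suc n) = y (legNode i n)

  next : (V → ℤ) → Fin ℓ → ℕ → ℤ
  next y i n = if n <ᵇ k i then y (legNode i (suc n)) else 0ℤ

  neighbourSum-center : (y : V → ℤ) → neighbourSum y center ≡ ∑ ℓ (λ i → y (node i zero))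
  neighbourSum-center y = begin
    0ℤ * y center + ∑ ℓ (λ i → ∑ (suc (k i)) (term i))
      ≡⟨ ℤ.+-identityˡ _ ⟩
    ∑ ℓ (λ i → ∑ (suc (k i)) (term i))
      ≡⟨ ∑-cong ℓ (λ i → ∑-single (suc (k i)) (term i) zero (off-first i)) ⟩
    ∑ ℓ (λ i → 1ℤ * y (node i zero))
      ≡⟨ ∑-cong ℓ (λ i → ℤ.*-identityˡ (y (node i zero))) ⟩
    ∑ ℓ (λ i → y (node i zero)) ∎
    where
    open ≡-Reasoning
    term : (i : Fin ℓ) → Fin (suc (k i)) → ℤ
    term i j = A {k = k} center (node i j) * y (node i j)
    off-first : ∀ i j → ¬ j ≡ zero → term i j ≡ 0ℤ
    off-first i zero    j≢0 = contradiction refl j≢0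
    off-first i (suc j) _   = refl

  private
    succSum predSum : (y : V → ℤ) (i : Fin ℓ) → Fin (suc (k i)) → ℤ
    succSum y i j = ∑ (suc (k i)) (λ j′ → indicator (suc (toℕ j) ≡ᵇ toℕ j′) * y (node i j′))
    predSum y i j = ∑ (suc (k i)) (λ j′ → indicator (suc (toℕ j′) ≡ᵇ toℕ j) * y (node i j′))

    neighbourSum-node-sums : (y : V → ℤ) (i : Fin ℓ) (j : Fin (suc (k i))) →
      neighbourSum y (node i j) ≡ indicator (toℕ j ≡ᵇ 0) * y center + (succSum y i j + predSum y i j)
    neighbourSum-node-sums y i j = cong (λ s → indicator (toℕ j ≡ᵇ 0) * y center + s) (begin
      ∑ ℓ (λ q → ∑ (suc (k q)) (term q))
        ≡⟨ ∑-single ℓ (λ q → ∑ (suc (k q)) (term q)) i other-leg ⟩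
      ∑ (suc (k i)) (λ j′ → indicator ((toℕ i ≡ᵇ toℕ i) ∧ adjacent j′) * y (node i j′))
        ≡⟨ ∑-cong (suc (k i)) (λ j′ →
             cong (λ b → indicator (b ∧ adjacent j′) * y (node i j′)) (≡ᵇ-refl (toℕ i))) ⟩
      ∑ (suc (k i)) (λ j′ → indicator (adjacent j′) * y (node i j′))
        ≡⟨ ∑-cong (suc (k i)) (λ j′ → indicator-∨ (succ j′) (pred j′) (y (node i j′))
                                                   (pred-and-succ-differ (toℕ j) (toℕ j′))) ⟩
      ∑ (suc (k i)) (λ j′ → indicator (succ j′) * y (node i j′) + indicator (pred j′) * y (node i j′))
        ≡⟨ ∑-distrib-+ (suc (k i)) (λ j′ → indicator (succ j′) * y (node i j′))
                                   (λ j′ → indicator (pred j′) * y (node i j′)) ⟩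
      succSum y i j + predSum y i j ∎)
      where
      open ≡-Reasoning
      term : (q : Fin ℓ) → Fin (suc (k q)) → ℤ
      term q j′ = A {k = k} (node i j) (node q j′) * y (node q j′)
      succ pred adjacent : Fin (suc (k i)) → Bool
      succ j′ = suc (toℕ j) ≡ᵇ toℕ j′
      pred j′ = suc (toℕ j′) ≡ᵇ toℕ j
      adjacent j′ = succ j′ ∨ pred j′
      other-leg : ∀ q → ¬ q ≡ i → ∑ (suc (k q)) (term q) ≡ 0ℤ
      other-leg q q≢i = ∑-zero (suc (k q)) (term q) (λ j′ → indicator-false (y (node q j′)) (λ t →
        q≢i (sym (Fin.toℕ-injective (ℕ.≡ᵇ⇒≡ (toℕ i) (toℕ q) (proj₁ (Equivalence.to T-∧ t)))))))

    predSum-prev : (y : V → ℤ) (i : Fin ℓ) (j : Fin (suc (k i))) (n : ℕ) → toℕ j ≡ n →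
      indicator (toℕ j ≡ᵇ 0) * y center + predSum y i j ≡ prev y i n
    predSum-prev y i j zero j≡0 = begin
      indicator (toℕ j ≡ᵇ 0) * y center + predSum y i j
        ≡⟨ cong₂ _+_ (indicator-true (y center) (ℕ.≡⇒≡ᵇ _ _ j≡0))
                     (∑-zero (suc (k i)) (λ j′ → indicator (suc (toℕ j′) ≡ᵇ toℕ j) * y (node i j′))
                             (λ j′ → indicator-false (y (node i j′)) (λ t →
                        ℕ.1+n≢0 (trans (ℕ.≡ᵇ⇒≡ (suc (toℕ j′)) (toℕ j) t) j≡0)))) ⟩
      y center + 0ℤ
        ≡⟨ ℤ.+-identityʳ _ ⟩
      y center ∎
      where open ≡-Reasoning
    predSum-prev y i j (suc n) j≡1+n = begin
      indicator (toℕ j ≡ᵇ 0) * y center + predSum y i j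
        ≡⟨ cong₂ _+_ (indicator-false (y center) (λ t →
                        ℕ.1+n≢0 (trans (sym j≡1+n) (ℕ.≡ᵇ⇒≡ _ _ t))))
                     (∑-cong (suc (k i)) (λ j′ → cong (λ b → indicator b * y (node i j′))
                        (trans (cong (suc (toℕ j′) ≡ᵇ_) j≡1+n) (≡ᵇ-sym (toℕ j′) n)))) ⟩
      0ℤ + ∑ (suc (k i)) (λ j′ → indicator (n ≡ᵇ toℕ j′) * y (node i j′))
        ≡⟨ ℤ.+-identityˡ _ ⟩
      ∑ (suc (k i)) (λ j′ → indicator (n ≡ᵇ toℕ j′) * y (node i j′))
        ≡⟨ ∑-indicator (k i) n (y ∘ node i) n≤k ⟩
      y (legNode i n) ∎
      where
      open ≡-Reasoning
      n≤k : n ≤ k i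
      n≤k = ℕ.<⇒≤ (subst (_≤ k i) j≡1+n (Fin.toℕ≤pred[n] j))

    succSum-next : (y : V → ℤ) (i : Fin ℓ) (j : Fin (suc (k i))) → succSum y i j ≡ next y i (toℕ j)
    succSum-next y i j with ℕ.<-cmp (toℕ j) (k i)
    ... | tri< j<k _ _ = trans (∑-indicator (k i) (suc (toℕ j)) (y ∘ node i) j<k)
                               (sym (if-true (ℕ.<⇒<ᵇ j<k)))
    ... | tri≈ _ j≡k _ = trans (∑-indicator-beyond (k i) (suc (toℕ j)) (y ∘ node i)
                                                   (s≤s (ℕ.≤-reflexive (sym j≡k))))
                               (sym (if-false (λ t → ℕ.<-irrefl j≡k (ℕ.<ᵇ⇒< _ _ t))))
    ... | tri> _ _ j>k = contradiction (Fin.toℕ≤pred[n] j) (ℕ.<⇒≱ j>k)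

  next-offLeg : (y : V → ℤ) (m : Fin ℓ) (n : ℕ) → (∀ j → y (node m j) ≡ 0ℤ) → next y m n ≡ 0ℤ
  next-offLeg y m n y≡0 with n <ᵇ k m
  ... | true  = y≡0 (clamp (suc n))
  ... | false = refl

  Lap-center : (d : V → ℕ) (y : V → ℤ) →
    Lap d y center ≡ + d center * y center - ∑ ℓ (λ i → y (node i zero))
  Lap-center d y = cong (λ s → + d center * y center - s) (neighbourSum-center y)

  Lap-node : (d : V → ℕ) (y : V → ℤ) (i : Fin ℓ) (j : Fin (suc (k i))) →
    Lap d y (node i j) ≡ + d (node i j) * y (node i j) - (prev y i (toℕ j) + next y i (toℕ j))
  Lap-node d y i j = cong (λ s → + d (node i j) * y (node i j) - s) (begin
    neighbourSum y (node i j)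
      ≡⟨ neighbourSum-node-sums y i j ⟩
    c + (succSum y i j + predSum y i j)
      ≡⟨ cong (λ s → c + s) (ℤ.+-comm (succSum y i j) (predSum y i j)) ⟩
    c + (predSum y i j + succSum y i j)
      ≡⟨ sym (ℤ.+-assoc c (predSum y i j) (succSum y i j)) ⟩
    (c + predSum y i j) + succSum y i j
      ≡⟨ cong₂ _+_ (predSum-prev y i j (toℕ j) refl) (succSum-next y i j) ⟩
    prev y i (toℕ j) + next y i (toℕ j) ∎)
    where
    open ≡-Reasoning
    c : ℤ
    c = indicator (toℕ j ≡ᵇ 0) * y center

  eCenter : V → ℤ
  eCenter center     = 1ℤ
  eCenter (node _ _) = 0ℤ

  ⟨,eCenter⟩ : (g : V → ℤ) → ⟨ g , eCenter ⟩ ≡ g center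
  ⟨,eCenter⟩ g = trans (sumV-center (λ v → g v * eCenter v) (λ i j → ℤ.*-zeroʳ (g (node i j))))
                       (ℤ.*-identityʳ (g center))

  atLeaves : (Fin ℓ → ℤ) → V → ℤ
  atLeaves z center     = 0ℤ
  atLeaves z (node m j) = indicator (k m ≡ᵇ toℕ j) * z m

  atLeaves-cong : {z z′ : Fin ℓ → ℤ} → (∀ i → z i ≡ z′ i) →
    ∀ v → atLeaves z v ≡ atLeaves z′ v
  atLeaves-cong z≡z′ center     = refl
  atLeaves-cong z≡z′ (node m j) = cong (indicator (k m ≡ᵇ toℕ j) *_) (z≡z′ m)

  atLeaves-scale : ∀ c (z : Fin ℓ → ℤ) v → atLeaves (λ i → c * z i) v ≡ c * atLeaves z v
  atLeaves-scale c z center     = sym (ℤ.*-zeroʳ c)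
  atLeaves-scale c z (node m j) = x∙yz≈y∙xz (indicator (k m ≡ᵇ toℕ j)) c (z m)

  ⟨,atLeaves⟩ : (g : V → ℤ) (z : Fin ℓ → ℤ) →
    ⟨ g , atLeaves z ⟩ ≡ ∑ ℓ (λ m → g (leaf m) * z m)
  ⟨,atLeaves⟩ g z =
    trans (cong (_+ legs) (ℤ.*-zeroʳ (g center))) (trans (ℤ.+-identityˡ legs) (∑-cong ℓ (λ m → begin
    ∑ (suc (k m)) (λ j → g (node m j) * (indicator (k m ≡ᵇ toℕ j) * z m))
      ≡⟨ ∑-cong (suc (k m)) (λ j → x∙yz≈y∙xz (g (node m j)) (indicator (k m ≡ᵇ toℕ j)) (z m)) ⟩
    ∑ (suc (k m)) (λ j → indicator (k m ≡ᵇ toℕ j) * (g (node m j) * z m))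
      ≡⟨ ∑-indicator (k m) (k m) (λ j → g (node m j) * z m) ℕ.≤-refl ⟩
    g (node m (clamp (k m))) * z m
      ≡⟨ cong (λ j → g (node m j) * z m) (clamp-fromℕ (k m)) ⟩
    g (leaf m) * z m ∎)))
    where
    open ≡-Reasoning
    legs : ℤ
    legs = ∑ ℓ (λ m → ∑ (suc (k m)) (λ j → g (node m j) * atLeaves z (node m j)))

-- Reduction to the leaves

module _ {ℓ : ℕ} {k : Fin ℓ → ℕ} (d : Vtx ℓ k → ℕ) where

  private
    V : Set
    V = Vtx ℓ k

  -- (value at position n − 1, value at position n) on leg m, position −1 being the centre
  legSolvePair : (V → ℤ) → (Fin ℓ → ℤ) → Fin ℓ → ℕ → ℤ × ℤ
  legSolvePair y b m zero    = 0ℤ , b m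
  legSolvePair y b m (suc n) =
    proj₂ (legSolvePair y b m n) ,
    + d (legNode m n) * proj₂ (legSolvePair y b m n) - proj₁ (legSolvePair y b m n) - y (legNode m n)

  legSolve : (V → ℤ) → (Fin ℓ → ℤ) → V → ℤ
  legSolve y b center     = 0ℤ
  legSolve y b (node m j) = proj₂ (legSolvePair y b m (toℕ j))

  prev-legSolve : ∀ y b m n → n ≤ k m → prev (legSolve y b) m n ≡ proj₁ (legSolvePair y b m n)
  prev-legSolve y b m zero    _     = refl
  prev-legSolve y b m (suc n) 1+n≤k = cong (proj₂ ∘ legSolvePair y b m) (toℕ-clamp n (ℕ.<⇒≤ 1+n≤k))

  next-legSolve : ∀ y b m n → n < k m → next (legSolve y b) m n ≡ proj₂ (legSolvePair y b m (suc n))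
  next-legSolve y b m n n<k =
    trans (if-true (ℕ.<⇒<ᵇ n<k)) (cong (proj₂ ∘ legSolvePair y b m) (toℕ-clamp (suc n) n<k))

  Lap-legSolve-inner : ∀ y b m (j : Fin (suc (k m))) → toℕ j < k m →
    Lap d (legSolve y b) (node m j) ≡ y (node m j)
  Lap-legSolve-inner y b m j j<k = begin
    Lap d (legSolve y b) (node m j)
      ≡⟨ Lap-node d (legSolve y b) m j ⟩
    + d (node m j) * x - (prev (legSolve y b) m n + next (legSolve y b) m n)
      ≡⟨ cong₂ (λ D s → + D * x - s) (cong (d ∘ node m) (sym (clamp-toℕ j)))
               (cong₂ _+_ (prev-legSolve y b m n (ℕ.<⇒≤ j<k)) (next-legSolve y b m n j<k)) ⟩
    D * x - (p + (D * x - p - y (legNode m n)))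
      ≡⟨ cancel D x p (y (legNode m n)) ⟩
    y (legNode m n)
      ≡⟨ cong (y ∘ node m) (clamp-toℕ j) ⟩
    y (node m j) ∎
    where
    open ≡-Reasoning
    n : ℕ
    n = toℕ j
    D p x : ℤ
    D = + d (legNode m n)
    p = proj₁ (legSolvePair y b m n)
    x = proj₂ (legSolvePair y b m n)
    cancel : ∀ D x p y → D * x - (p + (D * x - p - y)) ≡ y
    cancel = solve-∀

  Lap-legSolve-center : ∀ y b → Lap d (legSolve y b) center ≡ 0ℤ - ∑ ℓ b
  Lap-legSolve-center y b = trans (Lap-center d (legSolve y b)) (cong (_- ∑ ℓ b) (ℤ.*-zeroʳ (+ d center)))

  leafResidue : (V → ℤ) → (Fin ℓ → ℤ) → Fin ℓ → ℤ
  leafResidue y b m = y (leaf m) - Lap d (legSolve y b) (leaf m)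

  reduce-to-leaves : ∀ y b → y center + ∑ ℓ b ≡ 0ℤ →
    ∀ v → y v - Lap d (legSolve y b) v ≡ atLeaves (leafResidue y b) v
  reduce-to-leaves y b balanced center = begin
    y center - Lap d (legSolve y b) center ≡⟨ cong (λ s → y center - s) (Lap-legSolve-center y b) ⟩
    y center - (0ℤ - ∑ ℓ b)               ≡⟨ simplify (y center) (∑ ℓ b) ⟩
    y center + ∑ ℓ b                      ≡⟨ balanced ⟩
    0ℤ                                    ∎
    where
    open ≡-Reasoning
    simplify : ∀ x s → x - (0ℤ - s) ≡ x + s
    simplify = solve-∀
  reduce-to-leaves y b balanced (node m j) with ℕ.m≤n⇒m<n∨m≡n (Fin.toℕ≤pred[n] j)
  ... | inj₁ j<k = begin
    y (node m j) - Lap d (legSolve y b) (node m j)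
      ≡⟨ cong (λ s → y (node m j) - s) (Lap-legSolve-inner y b m j j<k) ⟩
    y (node m j) - y (node m j)
      ≡⟨ ℤ.+-inverseʳ (y (node m j)) ⟩
    0ℤ
      ≡⟨ sym (indicator-false (leafResidue y b m) (λ t → ℕ.<⇒≢ j<k (sym (ℕ.≡ᵇ⇒≡ _ _ t)))) ⟩
    atLeaves {k = k} (leafResidue y b) (node m j) ∎
    where open ≡-Reasoning
  ... | inj₂ j≡k
    with Fin.toℕ-injective {i = j} {j = fromℕ (k m)} (trans j≡k (sym (Fin.toℕ-fromℕ (k m))))
  ...   | refl = sym (indicator-true (leafResidue y b m) (ℕ.≡⇒≡ᵇ (k m) _ (sym j≡k)))

-- Arithmetical structures along the legs

module _ {ℓ : ℕ} {k : Fin ℓ → ℕ} (d r : Vtx ℓ k → ℕ) (as : IsArithmeticalStructure d r) where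

  private
    V : Set
    V = Vtx ℓ k

    r≢0 : ∀ v → NonZero (r v)
    r≢0 = proj₁ as

    r-primitive : ∀ m → (∀ v → m ∣ r v) → m ≡ 1
    r-primitive = proj₁ (proj₂ as)

    Lap-r : ∀ v → Lap d (λ u → + r u) v ≡ 0ℤ
    Lap-r = proj₂ (proj₂ as)

  rℤ : V → ℤ
  rℤ v = + r v

  rLeaf : Fin ℓ → ℕ
  rLeaf i = r (leaf i)

  rLeg : Fin ℓ → ℕ → ℕ
  rLeg i n = r (legNode i n)

  prevℕ nextℕ : Fin ℓ → ℕ → ℕ
  prevℕ i zero    = r center
  prevℕ i (suc n) = rLeg i n
  nextℕ i n = if n <ᵇ k i then rLeg i (suc n) else 0

  rLeg-leaf : ∀ i → rLeg i (k i) ≡ rLeaf i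
  rLeg-leaf i = cong (r ∘ node i) (clamp-fromℕ (k i))

  rLeg-toℕ : ∀ i (j : Fin (suc (k i))) → rLeg i (toℕ j) ≡ r (node i j)
  rLeg-toℕ i j = cong (r ∘ node i) (clamp-toℕ j)

  nextℕ-inner : ∀ i n → n < k i → nextℕ i n ≡ rLeg i (suc n)
  nextℕ-inner i n n<k = if-true (ℕ.<⇒<ᵇ n<k)

  nextℕ-leaf : ∀ i → nextℕ i (k i) ≡ 0
  nextℕ-leaf i = if-false (λ t → ℕ.<-irrefl refl (ℕ.<ᵇ⇒< (k i) (k i) t))

  r-recurrence : ∀ i n → n ≤ k i → d (legNode i n) ℕ.* rLeg i n ≡ prevℕ i n ℕ.+ nextℕ i n
  r-recurrence i n n≤k = ℤ.+-injective (begin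
    + (d (legNode i n) ℕ.* rLeg i n)
      ≡⟨ ℤ.pos-* (d (legNode i n)) (rLeg i n) ⟩
    + d (legNode i n) * rℤ (legNode i n)
      ≡⟨ ℤ.i-j≡0⇒i≡j _ _ (trans (sym (Lap-node d rℤ i (clamp n))) (Lap-r (legNode i n))) ⟩
    prev rℤ i (toℕ (clamp {k i} n)) + next rℤ i (toℕ (clamp {k i} n))
      ≡⟨ cong (λ m → prev rℤ i m + next rℤ i m) (toℕ-clamp n n≤k) ⟩
    prev rℤ i n + next rℤ i n
      ≡⟨ cong₂ _+_ (prev-r n) (sym (if-float +_ (n <ᵇ k i))) ⟩
    + prevℕ i n + + nextℕ i n
      ≡⟨ sym (ℤ.pos-+ (prevℕ i n) (nextℕ i n)) ⟩
    + (prevℕ i n ℕ.+ nextℕ i n) ∎)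
    where
    open ≡-Reasoning
    prev-r : ∀ n → prev rℤ i n ≡ + prevℕ i n
    prev-r zero    = refl
    prev-r (suc n) = refl

  private
    ∣-summand : ∀ {m} c {x y z} → c ℕ.* x ≡ y ℕ.+ z → m ∣ x → m ∣ y → m ∣ z
    ∣-summand {m} c e m∣x m∣y = ∣m+n∣m⇒∣n (subst (m ∣_) e (∣n⇒∣m*n c m∣x)) m∣y

  rLeaf∣rLeg-and-next : ∀ i t n → t ℕ.+ n ≡ k i → rLeaf i ∣ rLeg i n × rLeaf i ∣ nextℕ i n
  rLeaf∣rLeg-and-next i zero .(k i) refl =
    ∣-reflexive (sym (rLeg-leaf i)) , subst (rLeaf i ∣_) (sym (nextℕ-leaf i)) (rLeaf i ∣0)
  rLeaf∣rLeg-and-next i (suc t) n 1+t+n≡k =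
    ∣-summand (d (legNode i (suc n))) (trans (r-recurrence i (suc n) n<k) (ℕ.+-comm (rLeg i n) _))
              (proj₁ IH) (proj₂ IH) ,
    subst (rLeaf i ∣_) (sym (nextℕ-inner i n n<k)) (proj₁ IH)
    where
    n<k : n < k i
    n<k = subst (n <_) 1+t+n≡k (s≤s (ℕ.m≤n+m n t))
    IH : rLeaf i ∣ rLeg i (suc n) × rLeaf i ∣ nextℕ i (suc n)
    IH = rLeaf∣rLeg-and-next i t (suc n) (trans (ℕ.+-suc t n) 1+t+n≡k)

  rLeaf∣rLeg : ∀ i n → n ≤ k i → rLeaf i ∣ rLeg i n
  rLeaf∣rLeg i n n≤k = proj₁ (rLeaf∣rLeg-and-next i (k i ℕ.∸ n) n (ℕ.m∸n+n≡m n≤k))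

  rLeaf∣rCenter : ∀ i → rLeaf i ∣ r center
  rLeaf∣rCenter i =
    ∣-summand (d (legNode i 0)) (trans (r-recurrence i 0 z≤n) (ℕ.+-comm (r center) _))
              (proj₁ first) (proj₂ first)
    where
    first : rLeaf i ∣ rLeg i 0 × rLeaf i ∣ nextℕ i 0
    first = rLeaf∣rLeg-and-next i (k i) 0 (ℕ.+-identityʳ (k i))

  ∣center-and-first⇒∣leg : ∀ m i → m ∣ r center → m ∣ r (node i zero) →
    ∀ n → n ≤ k i → m ∣ prevℕ i n × m ∣ rLeg i n
  ∣center-and-first⇒∣leg m i m∣r₀ m∣first zero    _     = m∣r₀ , m∣first
  ∣center-and-first⇒∣leg m i m∣r₀ m∣first (suc n) 1+n≤k =
    proj₂ IH ,
    subst (m ∣_) (nextℕ-inner i n 1+n≤k)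
          (∣-summand (d (legNode i n)) (r-recurrence i n n≤k) (proj₂ IH) (proj₁ IH))
    where
    n≤k : n ≤ k i
    n≤k = ℕ.<⇒≤ 1+n≤k
    IH : m ∣ prevℕ i n × m ∣ rLeg i n
    IH = ∣center-and-first⇒∣leg m i m∣r₀ m∣first n n≤k

  center-and-firsts-coprime : ∀ m → m ∣ r center → (∀ i → m ∣ r (node i zero)) → m ≡ 1
  center-and-firsts-coprime m m∣r₀ m∣firsts = r-primitive m m∣r
    where
    m∣r : ∀ v → m ∣ r v
    m∣r center     = m∣r₀
    m∣r (node i j) = subst (m ∣_) (rLeg-toℕ i j)
      (proj₂ (∣center-and-first⇒∣leg m i m∣r₀ (m∣firsts i) (toℕ j) (Fin.toℕ≤pred[n] j)))

  leaves-coprime : Fin ℓ → ∀ m → (∀ i → m ∣ rLeaf i) → m ≡ 1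
  leaves-coprime o m m∣leaves = r-primitive m m∣r
    where
    m∣r : ∀ v → m ∣ r v
    m∣r center     = ∣-trans (m∣leaves o) (rLeaf∣rCenter o)
    m∣r (node i j) = ∣-trans (m∣leaves i)
      (subst (rLeaf i ∣_) (rLeg-toℕ i j) (rLeaf∣rLeg i (toℕ j) (Fin.toℕ≤pred[n] j)))

  -- The vectors w_i

  δ : Fin ℓ → Fin ℓ → ℤ
  δ m i = indicator (toℕ m ≡ᵇ toℕ i)

  δ-refl : ∀ i → δ i i ≡ 1ℤ
  δ-refl i = cong indicator (≡ᵇ-refl (toℕ i))

  δ-≢ : ∀ m i → ¬ m ≡ i → δ m i ≡ 0ℤ
  δ-≢ m i m≢i = trans (sym (ℤ.*-identityʳ (δ m i)))
                      (indicator-false 1ℤ (λ t → m≢i (Fin.toℕ-injective (ℕ.≡ᵇ⇒≡ _ _ t))))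

  rRatio : Fin ℓ → ℕ → ℤ
  rRatio i n = + (_/_ (rLeg i n) (rLeaf i) {{r≢0 (leaf i)}})

  dStarℤ : Fin ℓ → ℤ
  dStarℤ i = + dStar r r≢0 i

  rLeaf*rRatio : ∀ i n → n ≤ k i → + rLeaf i * rRatio i n ≡ + rLeg i n
  rLeaf*rRatio i n n≤k = trans (sym (ℤ.pos-* (rLeaf i) _))
    (cong +_ (m*[n/m]≡n {{r≢0 (leaf i)}} (rLeaf∣rLeg i n n≤k)))

  rLeaf*dStar : ∀ i → + rLeaf i * dStarℤ i ≡ rℤ center
  rLeaf*dStar i = trans (sym (ℤ.pos-* (rLeaf i) _))
    (cong +_ (m*[n/m]≡n {{r≢0 (leaf i)}} (rLeaf∣rCenter i)))

  rRatio-leaf : ∀ i → rRatio i (k i) ≡ 1ℤ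
  rRatio-leaf i = cong +_ (trans (cong (λ x → _/_ x (rLeaf i) {{r≢0 (leaf i)}}) (rLeg-leaf i))
                                 (n/n≡1 (rLeaf i) {{r≢0 (leaf i)}}))

  u : Fin ℓ → ℤ
  u i = rRatio i 0

  legWeight : Fin ℓ → V → ℤ
  legWeight i center     = dStarℤ i
  legWeight i (node m j) = δ m i * rRatio m (toℕ j)

  defect : Fin ℓ → V → ℤ
  defect i center     = + d center
  defect i (node m j) = - (indicator (toℕ j ≡ᵇ 0) * (1ℤ - δ m i))

  rLeaf*legWeight : ∀ i n → n ≤ k i → + rLeaf i * legWeight i (legNode i n) ≡ rℤ (legNode i n)
  rLeaf*legWeight i n n≤k = begin
    + rLeaf i * (δ i i * rRatio i (toℕ (clamp {k i} n)))
      ≡⟨ cong₂ (λ x m → + rLeaf i * (x * rRatio i m)) (δ-refl i) (toℕ-clamp n n≤k) ⟩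
    + rLeaf i * (1ℤ * rRatio i n)
      ≡⟨ cong (+ rLeaf i *_) (ℤ.*-identityˡ (rRatio i n)) ⟩
    + rLeaf i * rRatio i n
      ≡⟨ rLeaf*rRatio i n n≤k ⟩
    rℤ (legNode i n) ∎
    where open ≡-Reasoning

  rLeaf*prev : ∀ i n → n ≤ k i → + rLeaf i * prev (legWeight i) i n ≡ prev rℤ i n
  rLeaf*prev i zero    _     = rLeaf*dStar i
  rLeaf*prev i (suc n) 1+n≤k = rLeaf*legWeight i n (ℕ.<⇒≤ 1+n≤k)

  rLeaf*next : ∀ i n → + rLeaf i * next (legWeight i) i n ≡ next rℤ i n
  rLeaf*next i n with n <ᵇ k i in n<ᵇk
  ... | true  = rLeaf*legWeight i (suc n) (ℕ.<ᵇ⇒< n (k i) (subst T (sym n<ᵇk) _))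
  ... | false = ℤ.*-zeroʳ (+ rLeaf i)

  Lap-legWeight-ownLeg : ∀ i (j : Fin (suc (k i))) → Lap d (legWeight i) (node i j) ≡ 0ℤ
  Lap-legWeight-ownLeg i j = ℤ.*-cancelˡ-≡ (+ rLeaf i) _ 0ℤ {{r≢0 (leaf i)}} (begin
    + rLeaf i * Lap d w (node i j)
      ≡⟨ cong (+ rLeaf i *_) (Lap-node d w i j) ⟩
    + rLeaf i * (+ d (node i j) * w (node i j) - (prev w i n + next w i n))
      ≡⟨ distribute (+ rLeaf i) (+ d (node i j)) (w (node i j)) (prev w i n) (next w i n) ⟩
    + d (node i j) * (+ rLeaf i * w (node i j)) - (+ rLeaf i * prev w i n + + rLeaf i * next w i n)
      ≡⟨ cong₂ (λ x y → + d (node i j) * x - y) own-vertex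
               (cong₂ _+_ (rLeaf*prev i n (Fin.toℕ≤pred[n] j)) (rLeaf*next i n)) ⟩
    + d (node i j) * rℤ (node i j) - (prev rℤ i n + next rℤ i n)
      ≡⟨ sym (Lap-node d rℤ i j) ⟩
    Lap d rℤ (node i j)
      ≡⟨ trans (Lap-r (node i j)) (sym (ℤ.*-zeroʳ (+ rLeaf i))) ⟩
    + rLeaf i * 0ℤ ∎)
    where
    open ≡-Reasoning
    w : V → ℤ
    w = legWeight i
    n : ℕ
    n = toℕ j
    own-vertex : + rLeaf i * w (node i j) ≡ rℤ (node i j)
    own-vertex = subst (λ j′ → + rLeaf i * w (node i j′) ≡ rℤ (node i j′)) (clamp-toℕ j)
                       (rLeaf*legWeight i n (Fin.toℕ≤pred[n] j))
    distribute : ∀ c D x p q → c * (D * x - (p + q)) ≡ D * (c * x) - (c * p + c * q)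
    distribute = solve-∀

  legWeight-offLeg : ∀ i m (j : Fin (suc (k m))) → ¬ m ≡ i → legWeight i (node m j) ≡ 0ℤ
  legWeight-offLeg i m j m≢i = cong (_* rRatio m (toℕ j)) (δ-≢ m i m≢i)

  Lap-legWeight-offLeg : ∀ i m (j : Fin (suc (k m))) → ¬ m ≡ i →
    Lap d (legWeight i) (node m j) ≡ - (indicator (toℕ j ≡ᵇ 0) * dStarℤ i)
  Lap-legWeight-offLeg i m j m≢i = begin
    Lap d w (node m j)
      ≡⟨ Lap-node d w m j ⟩
    + d (node m j) * w (node m j) - (prev w m (toℕ j) + next w m (toℕ j))
      ≡⟨ cong₂ (λ x y → + d (node m j) * x - (prev w m (toℕ j) + y))
               (legWeight-offLeg i m j m≢i)
               (next-offLeg w m (toℕ j) (λ j′ → legWeight-offLeg i m j′ m≢i)) ⟩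
    + d (node m j) * 0ℤ - (prev w m (toℕ j) + 0ℤ)
      ≡⟨ simplify (+ d (node m j)) (prev w m (toℕ j)) ⟩
    - prev w m (toℕ j)
      ≡⟨ cong -_ (prev-first j) ⟩
    - (indicator (toℕ j ≡ᵇ 0) * dStarℤ i) ∎
    where
    open ≡-Reasoning
    w : V → ℤ
    w = legWeight i
    simplify : ∀ D p → D * 0ℤ - (p + 0ℤ) ≡ - p
    simplify = solve-∀
    prev-first : (j : Fin (suc (k m))) → prev w m (toℕ j) ≡ indicator (toℕ j ≡ᵇ 0) * dStarℤ i
    prev-first zero    = sym (ℤ.*-identityˡ (dStarℤ i))
    prev-first (suc j) = legWeight-offLeg i m (clamp (toℕ j)) m≢i

  Lap-legWeight-center : ∀ i → Lap d (legWeight i) center ≡ dStarℤ i * + d center - u i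
  Lap-legWeight-center i = begin
    Lap d (legWeight i) center
      ≡⟨ Lap-center d (legWeight i) ⟩
    + d center * dStarℤ i - ∑ ℓ (λ m → δ m i * u m)
      ≡⟨ cong (λ s → + d center * dStarℤ i - s) (∑-single ℓ (λ m → δ m i * u m) i off-i) ⟩
    + d center * dStarℤ i - δ i i * u i
      ≡⟨ cong₂ (λ x y → x - y * u i) (ℤ.*-comm (+ d center) (dStarℤ i)) (δ-refl i) ⟩
    dStarℤ i * + d center - 1ℤ * u i
      ≡⟨ cong (λ x → dStarℤ i * + d center - x) (ℤ.*-identityˡ (u i)) ⟩
    dStarℤ i * + d center - u i ∎
    where
    open ≡-Reasoning
    off-i : ∀ m → ¬ m ≡ i → δ m i * u m ≡ 0ℤ
    off-i m m≢i = cong (_* u m) (δ-≢ m i m≢i)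

  Lap-legWeight : ∀ i v → Lap d (legWeight i) v ≡ dStarℤ i * defect i v - u i * eCenter v
  Lap-legWeight i center =
    trans (Lap-legWeight-center i) (cong (λ x → dStarℤ i * + d center - x) (sym (ℤ.*-identityʳ (u i))))
  Lap-legWeight i (node m j) with m Fin.≟ i
  ... | yes refl = trans (Lap-legWeight-ownLeg i j) (sym (begin
    dStarℤ i * - (b * (1ℤ - δ i i)) - u i * 0ℤ
      ≡⟨ cong (λ x → dStarℤ i * - (b * (1ℤ - x)) - u i * 0ℤ) (δ-refl i) ⟩
    dStarℤ i * - (b * (1ℤ - 1ℤ)) - u i * 0ℤ
      ≡⟨ vanish (dStarℤ i) b (u i) ⟩
    0ℤ ∎))
    where
    open ≡-Reasoning
    b : ℤ
    b = indicator (toℕ j ≡ᵇ 0)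
    vanish : ∀ D b c → D * - (b * (1ℤ - 1ℤ)) - c * 0ℤ ≡ 0ℤ
    vanish = solve-∀
  ... | no m≢i = trans (Lap-legWeight-offLeg i m j m≢i) (sym (begin
    dStarℤ i * - (b * (1ℤ - δ m i)) - u i * 0ℤ
      ≡⟨ cong (λ x → dStarℤ i * - (b * (1ℤ - x)) - u i * 0ℤ) (δ-≢ m i m≢i) ⟩
    dStarℤ i * - (b * (1ℤ - 0ℤ)) - u i * 0ℤ
      ≡⟨ simplify (dStarℤ i) b (u i) ⟩
    - (b * dStarℤ i) ∎))
    where
    open ≡-Reasoning
    b : ℤ
    b = indicator (toℕ j ≡ᵇ 0)
    simplify : ∀ D b c → D * - (b * (1ℤ - 0ℤ)) - c * 0ℤ ≡ - (b * D)
    simplify = solve-∀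

  ⟨legWeight,Lap⟩ : ∀ i (a : V → ℤ) →
    ⟨ legWeight i , Lap d a ⟩ ≡ dStarℤ i * ⟨ defect i , a ⟩ - u i * a center
  ⟨legWeight,Lap⟩ i a = begin
    ⟨ legWeight i , Lap d a ⟩
      ≡⟨ Lap-selfAdjoint d (legWeight i) a ⟩
    ⟨ Lap d (legWeight i) , a ⟩
      ≡⟨ ⟨⟩-comm (Lap d (legWeight i)) a ⟩
    ⟨ a , Lap d (legWeight i) ⟩
      ≡⟨ ⟨⟩-congʳ a (Lap-legWeight i) ⟩
    ⟨ a , (λ v → dStarℤ i * defect i v - u i * eCenter v) ⟩
      ≡⟨ ⟨⟩-subʳ a (λ v → dStarℤ i * defect i v) (λ v → u i * eCenter v) ⟩
    ⟨ a , (λ v → dStarℤ i * defect i v) ⟩ - ⟨ a , (λ v → u i * eCenter v) ⟩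
      ≡⟨ cong₂ _-_ (⟨⟩-scaleʳ a (dStarℤ i) (defect i)) (⟨⟩-scaleʳ a (u i) eCenter) ⟩
    dStarℤ i * ⟨ a , defect i ⟩ - u i * ⟨ a , eCenter ⟩
      ≡⟨ cong₂ (λ x y → dStarℤ i * x - u i * y) (⟨⟩-comm a (defect i)) (⟨,eCenter⟩ a) ⟩
    dStarℤ i * ⟨ defect i , a ⟩ - u i * a center ∎
    where open ≡-Reasoning

  ⟨r,Lap⟩ : (a : V → ℤ) → ⟨ rℤ , Lap d a ⟩ ≡ 0ℤ
  ⟨r,Lap⟩ a = trans (Lap-selfAdjoint d rℤ a) (sumV-zero _ (λ v → cong (_* a v) (Lap-r v)))

  ⟨defect,⟩ : ∀ i (a : V → ℤ) →
    ⟨ defect i , a ⟩ ≡ + d center * a center - ∑ ℓ (λ m → (1ℤ - δ m i) * a (node m zero))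
  ⟨defect,⟩ i a = cong (λ s → + d center * a center + s) (begin
    ∑ ℓ (λ m → ∑ (suc (k m)) (λ j → defect i (node m j) * a (node m j)))
      ≡⟨ ∑-cong ℓ (λ m →
           ∑-single (suc (k m)) (λ j → defect i (node m j) * a (node m j)) zero (off-first m)) ⟩
    ∑ ℓ (λ m → - (1ℤ * (1ℤ - δ m i)) * a (node m zero))
      ≡⟨ ∑-cong ℓ (λ m → first (1ℤ - δ m i) (a (node m zero))) ⟩
    ∑ ℓ (λ m → - ((1ℤ - δ m i) * a (node m zero)))
      ≡⟨ ∑-neg ℓ (λ m → (1ℤ - δ m i) * a (node m zero)) ⟩
    - ∑ ℓ (λ m → (1ℤ - δ m i) * a (node m zero)) ∎)
    where
    open ≡-Reasoning
    first : ∀ p q → - (1ℤ * p) * q ≡ - (p * q)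
    first = solve-∀
    beyond : ∀ p q → - (0ℤ * p) * q ≡ 0ℤ
    beyond = solve-∀
    off-first : ∀ m (j : Fin (suc (k m))) → ¬ j ≡ zero → defect i (node m j) * a (node m j) ≡ 0ℤ
    off-first m zero    j≢0 = contradiction refl j≢0
    off-first m (suc j) _   = beyond (1ℤ - δ m i) (a (node m (suc j)))

  ⟨legWeight,atLeaves⟩ : ∀ i z → ⟨ legWeight i , atLeaves z ⟩ ≡ z i
  ⟨legWeight,atLeaves⟩ i z = begin
    ⟨ legWeight i , atLeaves z ⟩
      ≡⟨ ⟨,atLeaves⟩ (legWeight i) z ⟩
    ∑ ℓ (λ m → δ m i * rRatio m (toℕ (fromℕ (k m))) * z m)
      ≡⟨ ∑-single ℓ _ i (λ m m≢i →
           cong (λ x → x * rRatio m (toℕ (fromℕ (k m))) * z m) (δ-≢ m i m≢i)) ⟩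
    δ i i * rRatio i (toℕ (fromℕ (k i))) * z i
      ≡⟨ cong₂ (λ x n → x * rRatio i n * z i) (δ-refl i) (Fin.toℕ-fromℕ (k i)) ⟩
    1ℤ * rRatio i (k i) * z i
      ≡⟨ cong (λ x → 1ℤ * x * z i) (rRatio-leaf i) ⟩
    1ℤ * 1ℤ * z i
      ≡⟨ ℤ.*-identityˡ (z i) ⟩
    z i ∎
    where open ≡-Reasoning

  leafResidue-formula : ∀ y b → y center + ∑ ℓ b ≡ 0ℤ → ∀ i →
    leafResidue d y b i ≡ ⟨ legWeight i , y ⟩ + dStarℤ i * ∑ ℓ (λ m → (1ℤ - δ m i) * b m)
  leafResidue-formula y b balanced i = begin
    leafResidue d y b i
      ≡⟨ sym (⟨legWeight,atLeaves⟩ i (leafResidue d y b)) ⟩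
    ⟨ legWeight i , atLeaves (leafResidue d y b) ⟩
      ≡⟨ sym (⟨⟩-congʳ (legWeight i) (reduce-to-leaves d y b balanced)) ⟩
    ⟨ legWeight i , (λ v → y v - Lap d β v) ⟩
      ≡⟨ ⟨⟩-subʳ (legWeight i) y (Lap d β) ⟩
    ⟨ legWeight i , y ⟩ - ⟨ legWeight i , Lap d β ⟩
      ≡⟨ cong (λ x → ⟨ legWeight i , y ⟩ - x) (⟨legWeight,Lap⟩ i β) ⟩
    ⟨ legWeight i , y ⟩ - (dStarℤ i * ⟨ defect i , β ⟩ - u i * 0ℤ)
      ≡⟨ cong (λ x → ⟨ legWeight i , y ⟩ - (dStarℤ i * x - u i * 0ℤ)) (⟨defect,⟩ i β) ⟩
    ⟨ legWeight i , y ⟩ - (dStarℤ i * (+ d center * 0ℤ - S) - u i * 0ℤ)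
      ≡⟨ simplify ⟨ legWeight i , y ⟩ (dStarℤ i) (+ d center) S (u i) ⟩
    ⟨ legWeight i , y ⟩ + dStarℤ i * S ∎
    where
    open ≡-Reasoning
    β : V → ℤ
    β = legSolve d y b
    S : ℤ
    S = ∑ ℓ (λ m → (1ℤ - δ m i) * b m)
    simplify : ∀ p D dc S c → p - (D * (dc * 0ℤ - S) - c * 0ℤ) ≡ p + D * S
    simplify = solve-∀

  -- The functionals P, χ and ψ

  r₀ : ℤ
  r₀ = rℤ center

  private
    centerBezout : Σ ℤ λ c₀ → Σ (Fin ℓ → ℤ) λ c →
      c₀ * r₀ + ∑ ℓ (λ i → c i * + r (node i zero)) ≡ 1ℤ
    centerBezout = bezout-coprime ℓ (r center) (λ i → r (node i zero)) center-and-firsts-coprime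

  c₀ : ℤ
  c₀ = proj₁ centerBezout

  c : Fin ℓ → ℤ
  c = proj₁ (proj₂ centerBezout)

  bezout-center : c₀ * r₀ + ∑ ℓ (λ i → c i * + r (node i zero)) ≡ 1ℤ
  bezout-center = proj₂ (proj₂ centerBezout)

  leafPairing : (Fin ℓ → ℤ) → (Fin ℓ → ℤ) → ℤ
  leafPairing e z = ∑ ℓ (λ i → e i * (+ rLeaf i * z i))

  leafPairing-cong : ∀ e {z z′ : Fin ℓ → ℤ} → (∀ i → z i ≡ z′ i) →
    leafPairing e z ≡ leafPairing e z′
  leafPairing-cong e z≡z′ = ∑-cong ℓ (λ i → cong (λ x → e i * (+ rLeaf i * x)) (z≡z′ i))

  leafPairing-linear : ∀ e α (a : Fin ℓ → ℤ) β (b : Fin ℓ → ℤ) →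
    leafPairing e (λ i → α * a i + β * b i) ≡ α * leafPairing e a + β * leafPairing e b
  leafPairing-linear e α a β b = begin
    ∑ ℓ (λ i → e i * (+ rLeaf i * (α * a i + β * b i)))
      ≡⟨ ∑-cong ℓ (λ i → distribute (e i) (+ rLeaf i) α (a i) β (b i)) ⟩
    ∑ ℓ (λ i → α * (e i * (+ rLeaf i * a i)) + β * (e i * (+ rLeaf i * b i)))
      ≡⟨ ∑-distrib-+ ℓ (λ i → α * (e i * (+ rLeaf i * a i))) (λ i → β * (e i * (+ rLeaf i * b i))) ⟩
    ∑ ℓ (λ i → α * (e i * (+ rLeaf i * a i))) + ∑ ℓ (λ i → β * (e i * (+ rLeaf i * b i)))
      ≡⟨ sym (cong₂ _+_ (*-distribˡ-∑ ℓ α (λ i → e i * (+ rLeaf i * a i)))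
                        (*-distribˡ-∑ ℓ β (λ i → e i * (+ rLeaf i * b i)))) ⟩
    α * leafPairing e a + β * leafPairing e b ∎
    where
    open ≡-Reasoning
    distribute : ∀ e R α a β b → e * (R * (α * a + β * b)) ≡ α * (e * (R * a)) + β * (e * (R * b))
    distribute = solve-∀

  leafPairing-dStar : ∀ e (q F : Fin ℓ → ℤ) → (∀ i → F i ≡ q i * dStarℤ i) →
    leafPairing e F ≡ r₀ * ∑ ℓ (λ i → e i * q i)
  leafPairing-dStar e q F F≡qd* = begin
    ∑ ℓ (λ i → e i * (+ rLeaf i * F i))
      ≡⟨ ∑-cong ℓ (λ i → cong (λ x → e i * (+ rLeaf i * x)) (F≡qd* i)) ⟩
    ∑ ℓ (λ i → e i * (+ rLeaf i * (q i * dStarℤ i)))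
      ≡⟨ ∑-cong ℓ (λ i → trans (regroup (e i) (+ rLeaf i) (q i) (dStarℤ i))
                               (cong (_* (e i * q i)) (rLeaf*dStar i))) ⟩
    ∑ ℓ (λ i → r₀ * (e i * q i))
      ≡⟨ sym (*-distribˡ-∑ ℓ r₀ (λ i → e i * q i)) ⟩
    r₀ * ∑ ℓ (λ i → e i * q i) ∎
    where
    open ≡-Reasoning
    regroup : ∀ e R q D → e * (R * (q * D)) ≡ (R * D) * (e * q)
    regroup = solve-∀

  leafPairing-shape : ∀ e (p : Fin ℓ → ℤ) α β γ (a b : Fin ℓ → ℤ) →
    leafPairing e (λ i → p i - α * a i + β * a i + γ * b i)
    ≡ leafPairing e p - α * leafPairing e a + β * leafPairing e a + γ * leafPairing e b
  leafPairing-shape e p α β γ a b = begin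
    leafPairing e (λ i → p i - α * a i + β * a i + γ * b i)
      ≡⟨ leafPairing-cong e (λ i → regroup (p i) α β γ (a i) (b i)) ⟩
    leafPairing e (λ i → 1ℤ * p i + 1ℤ * ((β - α) * a i + γ * b i))
      ≡⟨ leafPairing-linear e 1ℤ p 1ℤ (λ i → (β - α) * a i + γ * b i) ⟩
    1ℤ * leafPairing e p + 1ℤ * leafPairing e (λ i → (β - α) * a i + γ * b i)
      ≡⟨ cong (λ x → 1ℤ * leafPairing e p + 1ℤ * x) (leafPairing-linear e (β - α) a γ b) ⟩
    1ℤ * leafPairing e p + 1ℤ * ((β - α) * leafPairing e a + γ * leafPairing e b)
      ≡⟨ sym (regroup (leafPairing e p) α β γ (leafPairing e a) (leafPairing e b)) ⟩
    leafPairing e p - α * leafPairing e a + β * leafPairing e a + γ * leafPairing e b ∎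
    where
    open ≡-Reasoning
    regroup : ∀ p α β γ a b → p - α * a + β * a + γ * b ≡ 1ℤ * p + 1ℤ * ((β - α) * a + γ * b)
    regroup = solve-∀

  χ ψ : (Fin ℓ → ℤ) → ℤ
  χ = leafPairing c
  ψ = leafPairing (λ _ → 1ℤ)

  rLeaf*u : ∀ i → + rLeaf i * u i ≡ + r (node i zero)
  rLeaf*u i = rLeaf*rRatio i 0 z≤n

  χ-u : χ u ≡ 1ℤ - c₀ * r₀
  χ-u = begin
    ∑ ℓ (λ i → c i * (+ rLeaf i * u i))
      ≡⟨ ∑-cong ℓ (λ i → cong (c i *_) (rLeaf*u i)) ⟩
    ∑ ℓ (λ i → c i * + r (node i zero))
      ≡⟨ isolate (c₀ * r₀) _ ⟩
    c₀ * r₀ + ∑ ℓ (λ i → c i * + r (node i zero)) - c₀ * r₀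
      ≡⟨ cong (_- c₀ * r₀) bezout-center ⟩
    1ℤ - c₀ * r₀ ∎
    where
    open ≡-Reasoning
    isolate : ∀ a b → b ≡ a + b - a
    isolate = solve-∀

  ψ-u : ψ u ≡ + d center * r₀
  ψ-u = begin
    ∑ ℓ (λ i → 1ℤ * (+ rLeaf i * u i))
      ≡⟨ ∑-cong ℓ (λ i → trans (ℤ.*-identityˡ _) (rLeaf*u i)) ⟩
    ∑ ℓ (λ i → + r (node i zero))
      ≡⟨ sym (ℤ.i-j≡0⇒i≡j _ _ (trans (sym (Lap-center d rℤ)) (Lap-r center))) ⟩
    + d center * r₀ ∎
    where open ≡-Reasoning

  χ-dStar : χ dStarℤ ≡ r₀ * ∑ ℓ c
  χ-dStar = trans (leafPairing-dStar c (λ _ → 1ℤ) dStarℤ (λ i → sym (ℤ.*-identityˡ (dStarℤ i))))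
                  (cong (r₀ *_) (∑-cong ℓ (λ i → ℤ.*-identityʳ (c i))))

  P : (V → ℤ) → Fin ℓ → ℤ
  P y i = ⟨ legWeight i , y ⟩

  ∑rLeaf*legWeight : ∀ v →
    ∑ ℓ (λ i → + rLeaf i * legWeight i v) ≡ rℤ v + (+ ℓ - 1ℤ) * r₀ * eCenter v
  ∑rLeaf*legWeight center = begin
    ∑ ℓ (λ i → + rLeaf i * dStarℤ i) ≡⟨ ∑-cong ℓ rLeaf*dStar ⟩
    ∑ ℓ (λ _ → r₀)                   ≡⟨ ∑-const ℓ r₀ ⟩
    + ℓ * r₀                         ≡⟨ split (+ ℓ) r₀ ⟩
    r₀ + (+ ℓ - 1ℤ) * r₀ * 1ℤ        ∎
    where
    open ≡-Reasoning
    split : ∀ l r → l * r ≡ r + (l - 1ℤ) * r * 1ℤ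
    split = solve-∀
  ∑rLeaf*legWeight (node m j) = begin
    ∑ ℓ (λ i → + rLeaf i * (δ m i * rRatio m (toℕ j)))
      ≡⟨ ∑-single ℓ _ m off-m ⟩
    + rLeaf m * (δ m m * rRatio m (toℕ j))
      ≡⟨ cong (λ x → + rLeaf m * (x * rRatio m (toℕ j))) (δ-refl m) ⟩
    + rLeaf m * (1ℤ * rRatio m (toℕ j))
      ≡⟨ cong (+ rLeaf m *_) (ℤ.*-identityˡ _) ⟩
    + rLeaf m * rRatio m (toℕ j)
      ≡⟨ rLeaf*rRatio m (toℕ j) (Fin.toℕ≤pred[n] j) ⟩
    + rLeg m (toℕ j)
      ≡⟨ cong +_ (rLeg-toℕ m j) ⟩
    rℤ (node m j)
      ≡⟨ pad (rℤ (node m j)) (+ ℓ - 1ℤ) r₀ ⟩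
    rℤ (node m j) + (+ ℓ - 1ℤ) * r₀ * 0ℤ ∎
    where
    open ≡-Reasoning
    off-m : ∀ i → ¬ i ≡ m → + rLeaf i * (δ m i * rRatio m (toℕ j)) ≡ 0ℤ
    off-m i i≢m = trans (cong (λ x → + rLeaf i * (x * rRatio m (toℕ j))) (δ-≢ m i (i≢m ∘ sym)))
                        (ℤ.*-zeroʳ (+ rLeaf i))
    pad : ∀ x a b → x ≡ x + a * b * 0ℤ
    pad = solve-∀

  ψ-P : ∀ y → ψ (P y) ≡ ⟨ rℤ , y ⟩ + (+ ℓ - 1ℤ) * r₀ * y center
  ψ-P y = begin
    ∑ ℓ (λ i → 1ℤ * (+ rLeaf i * ⟨ legWeight i , y ⟩))
      ≡⟨ ∑-cong ℓ (λ i →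
           trans (ℤ.*-identityˡ _) (*-distribˡ-sumV (+ rLeaf i) (λ v → legWeight i v * y v))) ⟩
    ∑ ℓ (λ i → sumV (λ v → + rLeaf i * (legWeight i v * y v)))
      ≡⟨ sym (sumV-∑-comm ℓ (λ v i → + rLeaf i * (legWeight i v * y v))) ⟩
    sumV (λ v → ∑ ℓ (λ i → + rLeaf i * (legWeight i v * y v)))
      ≡⟨ sumV-cong (λ v → trans (∑-cong ℓ (λ i → sym (ℤ.*-assoc (+ rLeaf i) (legWeight i v) (y v))))
                                (sym (*-distribʳ-∑ ℓ (y v) (λ i → + rLeaf i * legWeight i v)))) ⟩
    sumV (λ v → ∑ ℓ (λ i → + rLeaf i * legWeight i v) * y v)
      ≡⟨ sumV-cong (λ v → cong (_* y v) (∑rLeaf*legWeight v)) ⟩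
    ⟨ (λ v → rℤ v + (+ ℓ - 1ℤ) * r₀ * eCenter v) , y ⟩
      ≡⟨ trans (⟨⟩-comm (λ v → rℤ v + (+ ℓ - 1ℤ) * r₀ * eCenter v) y)
               (⟨⟩-congʳ y (λ v →
                  cong (_+ (+ ℓ - 1ℤ) * r₀ * eCenter v) (sym (ℤ.*-identityˡ (rℤ v))))) ⟩
    ⟨ y , (λ v → 1ℤ * rℤ v + (+ ℓ - 1ℤ) * r₀ * eCenter v) ⟩
      ≡⟨ ⟨⟩-linearʳ y 1ℤ rℤ ((+ ℓ - 1ℤ) * r₀) eCenter ⟩
    1ℤ * ⟨ y , rℤ ⟩ + (+ ℓ - 1ℤ) * r₀ * ⟨ y , eCenter ⟩
      ≡⟨ cong₂ (λ a b → a + (+ ℓ - 1ℤ) * r₀ * b)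
               (trans (ℤ.*-identityˡ _) (⟨⟩-comm y rℤ)) (⟨,eCenter⟩ y) ⟩
    ⟨ rℤ , y ⟩ + (+ ℓ - 1ℤ) * r₀ * y center ∎
    where open ≡-Reasoning

  P-atLeaves : ∀ (w₀ : Fin ℓ → ℤ) q i →
    P (λ v → atLeaves w₀ v - q * eCenter v) i ≡ w₀ i - q * dStarℤ i
  P-atLeaves w₀ q i = begin
    ⟨ legWeight i , (λ v → atLeaves w₀ v - q * eCenter v) ⟩
      ≡⟨ ⟨⟩-subʳ (legWeight i) (atLeaves w₀) (λ v → q * eCenter v) ⟩
    ⟨ legWeight i , atLeaves w₀ ⟩ - ⟨ legWeight i , (λ v → q * eCenter v) ⟩
      ≡⟨ cong₂ _-_ (⟨legWeight,atLeaves⟩ i w₀)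
                   (trans (⟨⟩-scaleʳ (legWeight i) q eCenter) (cong (q *_) (⟨,eCenter⟩ (legWeight i)))) ⟩
    w₀ i - q * dStarℤ i ∎
    where open ≡-Reasoning

  χ-P-Lap : ∀ (a : V → ℤ) →
    χ (P (Lap d a)) ≡ r₀ * ∑ ℓ (λ j → c j * ⟨ defect j , a ⟩) - a center * (1ℤ - c₀ * r₀)
  χ-P-Lap a = begin
    χ (P (Lap d a))
      ≡⟨ leafPairing-cong c (λ j →
           trans (⟨legWeight,Lap⟩ j a) (asCombination (dStarℤ j) (E j) (u j) (a center))) ⟩
    χ (λ j → 1ℤ * (E j * dStarℤ j) + (- a center) * u j)
      ≡⟨ leafPairing-linear c 1ℤ (λ j → E j * dStarℤ j) (- a center) u ⟩
    1ℤ * χ (λ j → E j * dStarℤ j) + (- a center) * χ u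
      ≡⟨ cong₂ (λ p q → 1ℤ * p + (- a center) * q) (leafPairing-dStar c E _ (λ _ → refl)) χ-u ⟩
    1ℤ * (r₀ * ∑ ℓ (λ j → c j * E j)) + (- a center) * (1ℤ - c₀ * r₀)
      ≡⟨ tidy (r₀ * ∑ ℓ (λ j → c j * E j)) (a center) (1ℤ - c₀ * r₀) ⟩
    r₀ * ∑ ℓ (λ j → c j * E j) - a center * (1ℤ - c₀ * r₀) ∎
    where
    open ≡-Reasoning
    E : Fin ℓ → ℤ
    E j = ⟨ defect j , a ⟩
    asCombination : ∀ D e u ac → D * e - u * ac ≡ 1ℤ * (e * D) + (- ac) * u
    asCombination = solve-∀
    tidy : ∀ p a q → 1ℤ * p + (- a) * q ≡ p - a * q
    tidy = solve-∀

  ∑-δ-complement : ∀ i (g : Fin ℓ → ℤ) → ∑ ℓ (λ m → (1ℤ - δ m i) * g m) ≡ ∑ ℓ g - g i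
  ∑-δ-complement i g = begin
    ∑ ℓ (λ m → (1ℤ - δ m i) * g m)
      ≡⟨ ∑-cong ℓ (λ m → expand (δ m i) (g m)) ⟩
    ∑ ℓ (λ m → g m - δ m i * g m)
      ≡⟨ ∑-sub ℓ g (λ m → δ m i * g m) ⟩
    ∑ ℓ g - ∑ ℓ (λ m → δ m i * g m)
      ≡⟨ cong (λ x → ∑ ℓ g - x) (∑-single ℓ _ i (λ m m≢i → cong (_* g m) (δ-≢ m i m≢i))) ⟩
    ∑ ℓ g - δ i i * g i
      ≡⟨ cong (λ x → ∑ ℓ g - x * g i) (δ-refl i) ⟩
    ∑ ℓ g - 1ℤ * g i
      ≡⟨ cong (λ x → ∑ ℓ g - x) (ℤ.*-identityˡ (g i)) ⟩
    ∑ ℓ g - g i ∎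
    where
    open ≡-Reasoning
    expand : ∀ δ g → (1ℤ - δ) * g ≡ g - δ * g
    expand = solve-∀

  Lap-eCenter-center : Lap d eCenter center ≡ + d center
  Lap-eCenter-center = begin
    Lap d eCenter center
      ≡⟨ Lap-center d eCenter ⟩
    + d center * 1ℤ - ∑ ℓ (λ _ → 0ℤ)
      ≡⟨ cong₂ _-_ (ℤ.*-identityʳ (+ d center)) (∑-zero ℓ _ (λ _ → refl)) ⟩
    + d center - 0ℤ
      ≡⟨ ℤ.+-identityʳ (+ d center) ⟩
    + d center ∎
    where open ≡-Reasoning

  ⟨legWeight,Lap-eCenter⟩ : ∀ i → ⟨ legWeight i , Lap d eCenter ⟩ ≡ dStarℤ i * + d center - u i
  ⟨legWeight,Lap-eCenter⟩ i = begin
    ⟨ legWeight i , Lap d eCenter ⟩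
      ≡⟨ ⟨legWeight,Lap⟩ i eCenter ⟩
    dStarℤ i * ⟨ defect i , eCenter ⟩ - u i * 1ℤ
      ≡⟨ cong₂ (λ x y → dStarℤ i * x - y) (⟨,eCenter⟩ (defect i)) (ℤ.*-identityʳ (u i)) ⟩
    dStarℤ i * + d center - u i ∎
    where open ≡-Reasoning

  centerCorrection : ℤ → (Fin ℓ → ℤ) → V → ℤ
  centerCorrection X σ v = (X * + d center + ∑ ℓ σ) * eCenter v + (- X) * Lap d eCenter v

  centerCorrection-balanced : ∀ X σ → centerCorrection X σ center + ∑ ℓ (λ m → - σ m) ≡ 0ℤ
  centerCorrection-balanced X σ = begin
    (X * + d center + ∑ ℓ σ) * 1ℤ + (- X) * Lap d eCenter center + ∑ ℓ (λ m → - σ m)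
      ≡⟨ cong₂ (λ l s → (X * + d center + ∑ ℓ σ) * 1ℤ + (- X) * l + s)
               Lap-eCenter-center (∑-neg ℓ σ) ⟩
    (X * + d center + ∑ ℓ σ) * 1ℤ + (- X) * + d center + - ∑ ℓ σ
      ≡⟨ cancel X (+ d center) (∑ ℓ σ) ⟩
    0ℤ ∎
    where
    open ≡-Reasoning
    cancel : ∀ X D S → (X * D + S) * 1ℤ + (- X) * D + - S ≡ 0ℤ
    cancel = solve-∀

  leafResidue-centerCorrection : ∀ X σ i →
    leafResidue d (centerCorrection X σ) (λ m → - σ m) i ≡ X * u i + dStarℤ i * σ i
  leafResidue-centerCorrection X σ i = begin
    leafResidue d y′ b′ i
      ≡⟨ leafResidue-formula y′ b′ (centerCorrection-balanced X σ) i ⟩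
    ⟨ legWeight i , y′ ⟩ + dStarℤ i * ∑ ℓ (λ m → (1ℤ - δ m i) * b′ m)
      ≡⟨ cong₂ (λ p s → p + dStarℤ i * s)
               (trans (⟨⟩-linearʳ (legWeight i) κ eCenter (- X) (Lap d eCenter))
                      (cong₂ (λ p q → κ * p + (- X) * q)
                             (⟨,eCenter⟩ (legWeight i)) (⟨legWeight,Lap-eCenter⟩ i)))
               (trans (∑-δ-complement i b′) (cong (_- b′ i) (∑-neg ℓ σ))) ⟩
    (κ * dStarℤ i + (- X) * (dStarℤ i * + d center - u i)) + dStarℤ i * (- ∑ ℓ σ - - σ i)
      ≡⟨ collect X (+ d center) (∑ ℓ σ) (dStarℤ i) (u i) (σ i) ⟩
    X * u i + dStarℤ i * σ i ∎
    where
    open ≡-Reasoning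
    κ : ℤ
    κ = X * + d center + ∑ ℓ σ
    y′ : V → ℤ
    y′ = centerCorrection X σ
    b′ : Fin ℓ → ℤ
    b′ m = - σ m
    collect : ∀ X D S d* u σ →
      ((X * D + S) * d* + (- X) * (d* * D - u)) + d* * (- S - - σ) ≡ X * u + d* * σ
    collect = solve-∀

  -- Pairing with r, which kills im L, leaves only r₀ times the coefficient of eCenter.
  centerCorrection-coefficient≡0 : ∀ y (β β′ : V → ℤ) X σ → ⟨ rℤ , y ⟩ ≡ 0ℤ →
    (∀ v → y v - Lap d β v ≡ centerCorrection X σ v - Lap d β′ v) → X * + d center + ∑ ℓ σ ≡ 0ℤ
  centerCorrection-coefficient≡0 y β β′ X σ ⟨r,y⟩≡0 same-reduction =
    ℤ.*-cancelˡ-≡ r₀ κ 0ℤ {{r≢0 center}} (begin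
      r₀ * κ
        ≡⟨ pad κ r₀ X ⟩
      κ * r₀ + (- X) * 0ℤ - 0ℤ
        ≡⟨ cong₂ (λ p w → p - w)
                 (cong₂ (λ p z → κ * p + (- X) * z) (sym (⟨,eCenter⟩ rℤ)) (sym (⟨r,Lap⟩ eCenter)))
                 (sym (⟨r,Lap⟩ β′)) ⟩
      κ * ⟨ rℤ , eCenter ⟩ + (- X) * ⟨ rℤ , Lap d eCenter ⟩ - ⟨ rℤ , Lap d β′ ⟩
        ≡⟨ cong (_- ⟨ rℤ , Lap d β′ ⟩) (sym (⟨⟩-linearʳ rℤ κ eCenter (- X) (Lap d eCenter))) ⟩
      ⟨ rℤ , y′ ⟩ - ⟨ rℤ , Lap d β′ ⟩
        ≡⟨ sym (⟨⟩-subʳ rℤ y′ (Lap d β′)) ⟩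
      ⟨ rℤ , (λ v → y′ v - Lap d β′ v) ⟩
        ≡⟨ sym (⟨⟩-congʳ rℤ same-reduction) ⟩
      ⟨ rℤ , (λ v → y v - Lap d β v) ⟩
        ≡⟨ ⟨⟩-subʳ rℤ y (Lap d β) ⟩
      ⟨ rℤ , y ⟩ - ⟨ rℤ , Lap d β ⟩
        ≡⟨ cong₂ _-_ ⟨r,y⟩≡0 (⟨r,Lap⟩ β) ⟩
      0ℤ
        ≡⟨ sym (ℤ.*-zeroʳ r₀) ⟩
      r₀ * 0ℤ ∎)
    where
    open ≡-Reasoning
    κ : ℤ
    κ = X * + d center + ∑ ℓ σ
    y′ : V → ℤ
    y′ = centerCorrection X σ
    pad : ∀ κ r X → r * κ ≡ κ * r + (- X) * 0ℤ - 0ℤ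
    pad = solve-∀

  inImage-if-reduces-like-centerCorrection : ∀ y (β β′ : V → ℤ) X σ → ⟨ rℤ , y ⟩ ≡ 0ℤ →
    (∀ v → y v - Lap d β v ≡ centerCorrection X σ v - Lap d β′ v) → InImage d y
  inImage-if-reduces-like-centerCorrection y β β′ X σ ⟨r,y⟩≡0 same-reduction = a , y≡Lap-a
    where
    open ≡-Reasoning
    κ≡0 : X * + d center + ∑ ℓ σ ≡ 0ℤ
    κ≡0 = centerCorrection-coefficient≡0 y β β′ X σ ⟨r,y⟩≡0 same-reduction
    a₁ a : V → ℤ
    a₁ v = 1ℤ * β v + (- 1ℤ) * β′ v
    a  v = 1ℤ * a₁ v + (- X) * eCenter v
    y≡Lap-a : ∀ v → y v ≡ Lap d a v
    y≡Lap-a v = begin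
      y v
        ≡⟨ split (y v) (Lap d β v) ⟩
      (y v - Lap d β v) + Lap d β v
        ≡⟨ cong (_+ Lap d β v) (same-reduction v) ⟩
      ((X * + d center + ∑ ℓ σ) * eCenter v + (- X) * Lap d eCenter v - Lap d β′ v) + Lap d β v
        ≡⟨ cong (λ κ → (κ * eCenter v + (- X) * Lap d eCenter v - Lap d β′ v) + Lap d β v) κ≡0 ⟩
      (0ℤ * eCenter v + (- X) * Lap d eCenter v - Lap d β′ v) + Lap d β v
        ≡⟨ collect (eCenter v) X (Lap d eCenter v) (Lap d β′ v) (Lap d β v) ⟩
      1ℤ * (1ℤ * Lap d β v + (- 1ℤ) * Lap d β′ v) + (- X) * Lap d eCenter v
        ≡⟨ cong (λ x → 1ℤ * x + (- X) * Lap d eCenter v) (sym (Lap-lin d 1ℤ (- 1ℤ) β β′ v)) ⟩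
      1ℤ * Lap d a₁ v + (- X) * Lap d eCenter v
        ≡⟨ sym (Lap-lin d 1ℤ (- X) a₁ eCenter v) ⟩
      Lap d a v ∎
      where
      split : ∀ y l → y ≡ (y - l) + l
      split = solve-∀
      collect : ∀ e X le lb′ lb →
        (0ℤ * e + (- X) * le - lb′) + lb ≡ 1ℤ * (1ℤ * lb + (- 1ℤ) * lb′) + (- X) * le
      collect = solve-∀

  ⟨r,torsion⟩≡0 : ∀ y → IsTorsion d y → ⟨ rℤ , y ⟩ ≡ 0ℤ
  ⟨r,torsion⟩≡0 y (m , a , my≡Lap-a) = ℤ.*-cancelˡ-≡ (+ suc m) _ 0ℤ (begin
    + suc m * ⟨ rℤ , y ⟩                ≡⟨ sym (⟨⟩-scaleʳ rℤ (+ suc m) y) ⟩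
    ⟨ rℤ , (λ v → + suc m * y v) ⟩      ≡⟨ ⟨⟩-congʳ rℤ my≡Lap-a ⟩
    ⟨ rℤ , Lap d a ⟩                    ≡⟨ ⟨r,Lap⟩ a ⟩
    0ℤ                                  ≡⟨ sym (ℤ.*-zeroʳ (+ suc m)) ⟩
    + suc m * 0ℤ                        ∎)
    where open ≡-Reasoning

  r₀-multiple-inImage : ∀ (w₀ : Fin ℓ → ℤ) q → ψ w₀ ≡ r₀ * q →
    InImage d (λ v → r₀ * (atLeaves w₀ v - q * eCenter v))
  r₀-multiple-inImage w₀ q ψw₀≡r₀q = (λ v → (- 1ℤ) * β v + 0ℤ * β v) , r₀y≡Lap
    where
    open ≡-Reasoning
    σ : Fin ℓ → ℤ
    σ i = + rLeaf i * w₀ i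
    y″ : V → ℤ
    y″ = centerCorrection 0ℤ σ
    b″ : Fin ℓ → ℤ
    b″ m = - σ m
    β : V → ℤ
    β = legSolve d y″ b″
    ∑σ≡r₀q : ∑ ℓ σ ≡ r₀ * q
    ∑σ≡r₀q = trans (∑-cong ℓ (λ i → sym (ℤ.*-identityˡ (σ i)))) ψw₀≡r₀q
    residue : ∀ i → leafResidue d y″ b″ i ≡ r₀ * w₀ i
    residue i = begin
      leafResidue d y″ b″ i
        ≡⟨ leafResidue-centerCorrection 0ℤ σ i ⟩
      0ℤ * u i + dStarℤ i * σ i
        ≡⟨ ℤ.+-identityˡ _ ⟩
      dStarℤ i * (+ rLeaf i * w₀ i)
        ≡⟨ sym (ℤ.*-assoc (dStarℤ i) (+ rLeaf i) (w₀ i)) ⟩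
      dStarℤ i * + rLeaf i * w₀ i
        ≡⟨ cong (_* w₀ i) (trans (ℤ.*-comm (dStarℤ i) (+ rLeaf i)) (rLeaf*dStar i)) ⟩
      r₀ * w₀ i ∎
    r₀y≡Lap : ∀ v →
      r₀ * (atLeaves w₀ v - q * eCenter v) ≡ Lap d (λ u → (- 1ℤ) * β u + 0ℤ * β u) v
    r₀y≡Lap v = begin
      r₀ * (atLeaves w₀ v - q * eCenter v)
        ≡⟨ distribute r₀ (atLeaves w₀ v) q (eCenter v) ⟩
      r₀ * atLeaves w₀ v - r₀ * q * eCenter v
        ≡⟨ cong₂ (λ x p → x - p * eCenter v) (sym (atLeaves-scale r₀ w₀ v)) (sym ∑σ≡r₀q) ⟩
      atLeaves (λ i → r₀ * w₀ i) v - ∑ ℓ σ * eCenter v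
        ≡⟨ cong (_- ∑ ℓ σ * eCenter v)
                (sym (trans (reduce-to-leaves d y″ b″ (centerCorrection-balanced 0ℤ σ) v)
                            (atLeaves-cong residue v))) ⟩
      ((0ℤ * + d center + ∑ ℓ σ) * eCenter v + (- 0ℤ) * Lap d eCenter v - Lap d β v)
        - ∑ ℓ σ * eCenter v
        ≡⟨ cancel (+ d center) (∑ ℓ σ) (eCenter v) (Lap d eCenter v) (Lap d β v) ⟩
      (- 1ℤ) * Lap d β v + 0ℤ * Lap d β v
        ≡⟨ sym (Lap-lin d (- 1ℤ) 0ℤ β β v) ⟩
      Lap d (λ u → (- 1ℤ) * β u + 0ℤ * β u) v ∎
      where
      distribute : ∀ r a q e → r * (a - q * e) ≡ r * a - r * q * e
      distribute = solve-∀
      cancel : ∀ D S e le lb → ((0ℤ * D + S) * e + (- 0ℤ) * le - lb) - S * e ≡ (- 1ℤ) * lb + 0ℤ * lb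
      cancel = solve-∀

  -- The isomorphism

  module _ (o : Fin ℓ) where

    private
      leafBezout : Σ ℤ λ c₀ → Σ (Fin ℓ → ℤ) λ ξ →
        c₀ * + 0 + ∑ ℓ (λ i → ξ i * + rLeaf i) ≡ 1ℤ
      leafBezout = bezout-coprime ℓ 0 rLeaf (λ m _ → leaves-coprime o m)

    ξ : Fin ℓ → ℤ
    ξ = proj₁ (proj₂ leafBezout)

    bezout-leaves : ∑ ℓ (λ i → ξ i * + rLeaf i) ≡ 1ℤ
    bezout-leaves = begin
      S                          ≡⟨ sym (ℤ.+-identityˡ S) ⟩
      0ℤ + S                     ≡⟨ cong (_+ S) (sym (ℤ.*-zeroʳ (proj₁ leafBezout))) ⟩
      proj₁ leafBezout * 0ℤ + S  ≡⟨ proj₂ (proj₂ leafBezout) ⟩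
      1ℤ                         ∎
      where
      open ≡-Reasoning
      S : ℤ
      S = ∑ ℓ (λ i → ξ i * + rLeaf i)

    ψ-ξ : ψ ξ ≡ 1ℤ
    ψ-ξ = trans (∑-cong ℓ (λ i → trans (ℤ.*-identityˡ _) (ℤ.*-comm (+ rLeaf i) (ξ i)))) bezout-leaves

    x̂ : Fin ℓ → ℤ
    x̂ i = ξ i - χ ξ * u i

    leafPairing-x̂ : ∀ e → leafPairing e x̂ ≡ leafPairing e ξ - χ ξ * leafPairing e u
    leafPairing-x̂ e = begin
      leafPairing e x̂
        ≡⟨ leafPairing-cong e (λ i → asCombination (ξ i) (χ ξ) (u i)) ⟩
      leafPairing e (λ i → 1ℤ * ξ i + (- χ ξ) * u i)
        ≡⟨ leafPairing-linear e 1ℤ ξ (- χ ξ) u ⟩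
      1ℤ * leafPairing e ξ + (- χ ξ) * leafPairing e u
        ≡⟨ sym (asCombination (leafPairing e ξ) (χ ξ) (leafPairing e u)) ⟩
      leafPairing e ξ - χ ξ * leafPairing e u ∎
      where
      open ≡-Reasoning
      asCombination : ∀ a b c → a - b * c ≡ 1ℤ * a + (- b) * c
      asCombination = solve-∀

    ψ-x̂ : ψ x̂ ≡ 1ℤ - χ ξ * (+ d center * r₀)
    ψ-x̂ = trans (leafPairing-x̂ (λ _ → 1ℤ)) (cong₂ (λ a b → a - χ ξ * b) ψ-ξ ψ-u)

    χ-x̂ : χ x̂ ≡ χ ξ - χ ξ * (1ℤ - c₀ * r₀)
    χ-x̂ = trans (leafPairing-x̂ c) (cong (λ b → χ ξ - χ ξ * b) χ-u)

    Φ : (V → ℤ) → ℤ → ℤ → Fin ℓ → ℤ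
    Φ y s t i = P y i - χ (P y) * u i + s * u i + t * x̂ i

    Φ-cong : ∀ {y y′ : V → ℤ} {s s′ t t′} i →
      (∀ v → y v ≡ y′ v) → s ≡ s′ → t ≡ t′ → Φ y s t i ≡ Φ y′ s′ t′ i
    Φ-cong {y} {y′} {s} {_} {t} i y≡y′ refl refl =
      cong₂ (λ p q → p - q * u i + s * u i + t * x̂ i)
            (⟨⟩-congʳ (legWeight i) y≡y′)
            (leafPairing-cong c (λ j → ⟨⟩-congʳ (legWeight j) y≡y′))

    Φ-linear : ∀ α (a : V → ℤ) β (b : V → ℤ) s₁ s₂ t₁ t₂ i →
      Φ (λ v → α * a v + β * b v) (α * s₁ + β * s₂) (α * t₁ + β * t₂) i
      ≡ α * Φ a s₁ t₁ i + β * Φ b s₂ t₂ i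
    Φ-linear α a β b s₁ s₂ t₁ t₂ i = begin
      P y i - χ (P y) * u i + (α * s₁ + β * s₂) * u i + (α * t₁ + β * t₂) * x̂ i
        ≡⟨ cong₂ (λ p q → p - q * u i + (α * s₁ + β * s₂) * u i + (α * t₁ + β * t₂) * x̂ i)
                 (⟨⟩-linearʳ (legWeight i) α a β b)
                 (trans (leafPairing-cong c (λ j → ⟨⟩-linearʳ (legWeight j) α a β b))
                        (leafPairing-linear c α (P a) β (P b))) ⟩
      (α * P a i + β * P b i) - (α * χ (P a) + β * χ (P b)) * u i
        + (α * s₁ + β * s₂) * u i + (α * t₁ + β * t₂) * x̂ i
        ≡⟨ collect α β (P a i) (P b i) (χ (P a)) (χ (P b)) (u i) (x̂ i) s₁ s₂ t₁ t₂ ⟩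
      α * Φ a s₁ t₁ i + β * Φ b s₂ t₂ i ∎
      where
      open ≡-Reasoning
      y : V → ℤ
      y v = α * a v + β * b v
      collect : ∀ α β pa pb ca cb u x s₁ s₂ t₁ t₂ →
        (α * pa + β * pb) - (α * ca + β * cb) * u + (α * s₁ + β * s₂) * u + (α * t₁ + β * t₂) * x
        ≡ α * (pa - ca * u + s₁ * u + t₁ * x) + β * (pb - cb * u + s₂ * u + t₂ * x)
      collect = solve-∀

    Φ-+ : ∀ (a b : V → ℤ) s₁ s₂ t₁ t₂ i →
      Φ (λ v → a v + b v) (s₁ + s₂) (t₁ + t₂) i ≡ Φ a s₁ t₁ i + Φ b s₂ t₂ i
    Φ-+ a b s₁ s₂ t₁ t₂ i =
      trans (Φ-cong i (λ v → unit (a v) (b v)) (unit s₁ s₂) (unit t₁ t₂))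
            (trans (Φ-linear 1ℤ a 1ℤ b s₁ s₂ t₁ t₂ i) (sym (unit (Φ a s₁ t₁ i) (Φ b s₂ t₂ i))))
      where
      unit : ∀ x y → x + y ≡ 1ℤ * x + 1ℤ * y
      unit = solve-∀

    Φ-sub : ∀ (a b : V → ℤ) s₁ s₂ t₁ t₂ i →
      Φ (λ v → a v - b v) (s₁ - s₂) (t₁ - t₂) i ≡ Φ a s₁ t₁ i - Φ b s₂ t₂ i
    Φ-sub a b s₁ s₂ t₁ t₂ i =
      trans (Φ-cong i (λ v → unit (a v) (b v)) (unit s₁ s₂) (unit t₁ t₂))
            (trans (Φ-linear 1ℤ a (- 1ℤ) b s₁ s₂ t₁ t₂ i)
                   (sym (unit (Φ a s₁ t₁ i) (Φ b s₂ t₂ i))))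
      where
      unit : ∀ x y → x - y ≡ 1ℤ * x + (- 1ℤ) * y
      unit = solve-∀

    Φ-neg : ∀ (a : V → ℤ) s t i → Φ (λ v → - a v) (- s) (- t) i ≡ - Φ a s t i
    Φ-neg a s t i =
      trans (Φ-cong i (λ v → unit (a v)) (unit s) (unit t))
            (trans (Φ-linear (- 1ℤ) a 0ℤ a s s t t i) (sym (unit (Φ a s t i))))
      where
      unit : ∀ x → - x ≡ (- 1ℤ) * x + 0ℤ * x
      unit = solve-∀

    Φ-zero : ∀ i → Φ (λ _ → 0ℤ) 0ℤ 0ℤ i ≡ 0ℤ
    Φ-zero i =
      trans (Φ-cong i (λ v → unit (eCenter v)) (unit 0ℤ) (unit 0ℤ))
            (trans (Φ-linear 0ℤ eCenter 0ℤ eCenter 0ℤ 0ℤ 0ℤ 0ℤ i) (sym (unit (Φ eCenter 0ℤ 0ℤ i))))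
      where
      unit : ∀ x → 0ℤ ≡ 0ℤ * x + 0ℤ * x
      unit = solve-∀

    Φ-Lap : ∀ (a : V → ℤ) σ τ i → Σ ℤ λ Q → Φ (Lap d a) (σ * r₀) (τ * r₀) i ≡ Q * dStarℤ i
    Φ-Lap a σ τ i = Q , (begin
      Φ (Lap d a) (σ * r₀) (τ * r₀) i
        ≡⟨ cong₂ (λ p q → p - q * u i + σ * r₀ * u i + τ * r₀ * x̂ i)
                 (⟨legWeight,Lap⟩ i a) (χ-P-Lap a) ⟩
      G r₀
        ≡⟨ cong G (sym (rLeaf*dStar i)) ⟩
      G (+ rLeaf i * dStarℤ i)
        ≡⟨ factor (+ rLeaf i) (dStarℤ i) (E i) (u i) (a center) M c₀ σ τ (x̂ i) ⟩
      Q * dStarℤ i ∎)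
      where
      open ≡-Reasoning
      E : Fin ℓ → ℤ
      E j = ⟨ defect j , a ⟩
      M : ℤ
      M = ∑ ℓ (λ j → c j * E j)
      G : ℤ → ℤ
      G r = (dStarℤ i * E i - u i * a center) - (r * M - a center * (1ℤ - c₀ * r)) * u i
            + σ * r * u i + τ * r * x̂ i
      Q : ℤ
      Q = E i - M * + rLeaf i * u i - a center * c₀ * + rLeaf i * u i
          + σ * + rLeaf i * u i + τ * + rLeaf i * x̂ i
      factor : ∀ R D e u ac M c₀ σ τ x →
        (D * e - u * ac) - ((R * D) * M - ac * (1ℤ - c₀ * (R * D))) * u + σ * (R * D) * u + τ * (R * D) * x
        ≡ (e - M * R * u - ac * c₀ * R * u + σ * R * u + τ * R * x) * D
      factor = solve-∀

    +∑-δ-cancel : ∀ x → x + ∑ ℓ (λ m → - (x * δ m o)) ≡ 0ℤ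
    +∑-δ-cancel x = begin
      x + ∑ ℓ (λ m → - (x * δ m o))
        ≡⟨ cong (λ y → x + y) (∑-neg ℓ (λ m → x * δ m o)) ⟩
      x + - ∑ ℓ (λ m → x * δ m o)
        ≡⟨ cong (λ y → x + - y) (∑-single ℓ _ o (λ m m≢o →
             trans (cong (x *_) (δ-≢ m o m≢o)) (ℤ.*-zeroʳ x))) ⟩
      x + - (x * δ o o)
        ≡⟨ cong (λ y → x + - (x * y)) (δ-refl o) ⟩
      x + - (x * 1ℤ)
        ≡⟨ cancel x ⟩
      0ℤ ∎
      where
      open ≡-Reasoning
      cancel : ∀ x → x + - (x * 1ℤ) ≡ 0ℤ
      cancel = solve-∀

    inImage-if-P≡u-mod-dStar : ∀ y X (q : Fin ℓ → ℤ) → ⟨ rℤ , y ⟩ ≡ 0ℤ →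
      (∀ i → P y i ≡ X * u i + q i * dStarℤ i) → InImage d y
    inImage-if-P≡u-mod-dStar y X q ⟨r,y⟩≡0 Py≡ =
      inImage-if-reduces-like-centerCorrection y β β′ X σ ⟨r,y⟩≡0 same-reduction
      where
      open ≡-Reasoning
      b : Fin ℓ → ℤ
      b m = - (y center * δ m o)  -- any b with Σ b = − y center would do
      σ : Fin ℓ → ℤ
      σ i = q i + ∑ ℓ (λ m → (1ℤ - δ m i) * b m)
      residue-y : ∀ i → leafResidue d y b i ≡ X * u i + dStarℤ i * σ i
      residue-y i = trans (leafResidue-formula y b (+∑-δ-cancel (y center)) i)
        (trans (cong (_+ dStarℤ i * ∑ ℓ (λ m → (1ℤ - δ m i) * b m)) (Py≡ i))
               (regroup X (u i) (q i) (dStarℤ i) (∑ ℓ (λ m → (1ℤ - δ m i) * b m))))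
        where
        regroup : ∀ X u q D S → X * u + q * D + D * S ≡ X * u + D * (q + S)
        regroup = solve-∀
      β β′ : V → ℤ
      β  = legSolve d y b
      β′ = legSolve d (centerCorrection X σ) (λ m → - σ m)
      same-reduction : ∀ v → y v - Lap d β v ≡ centerCorrection X σ v - Lap d β′ v
      same-reduction v = begin
        y v - Lap d β v
          ≡⟨ reduce-to-leaves d y b (+∑-δ-cancel (y center)) v ⟩
        atLeaves (leafResidue d y b) v
          ≡⟨ atLeaves-cong (λ i → trans (residue-y i) (sym (leafResidue-centerCorrection X σ i))) v ⟩
        atLeaves (leafResidue d (centerCorrection X σ) (λ m → - σ m)) v
          ≡⟨ sym (reduce-to-leaves d (centerCorrection X σ) (λ m → - σ m) (centerCorrection-balanced X σ) v) ⟩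
        centerCorrection X σ v - Lap d β′ v ∎

    χ-Φ : ∀ y s t → χ (Φ y s t) ≡ s + r₀ * ((χ (P y) - s + t * χ ξ) * c₀)
    χ-Φ y s t = begin
      χ (Φ y s t)
        ≡⟨ leafPairing-shape c (P y) (χ (P y)) s t u x̂ ⟩
      χ (P y) - χ (P y) * χ u + s * χ u + t * χ x̂
        ≡⟨ cong₂ (λ p q → χ (P y) - χ (P y) * p + s * p + t * q) χ-u χ-x̂ ⟩
      χ (P y) - χ (P y) * (1ℤ - c₀ * r₀) + s * (1ℤ - c₀ * r₀)
        + t * (χ ξ - χ ξ * (1ℤ - c₀ * r₀))
        ≡⟨ collect (χ (P y)) s t (χ ξ) c₀ r₀ ⟩
      s + r₀ * ((χ (P y) - s + t * χ ξ) * c₀) ∎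
      where
      open ≡-Reasoning
      collect : ∀ X s t Y c₀ r →
        X - X * (1ℤ - c₀ * r) + s * (1ℤ - c₀ * r) + t * (Y - Y * (1ℤ - c₀ * r))
        ≡ s + r * ((X - s + t * Y) * c₀)
      collect = solve-∀

    ψ-Φ : ∀ y s t → ⟨ rℤ , y ⟩ ≡ 0ℤ →
      ψ (Φ y s t) ≡ t + r₀ * ((+ ℓ - 1ℤ) * y center - (χ (P y) - s + t * χ ξ) * + d center)
    ψ-Φ y s t ⟨r,y⟩≡0 = begin
      ψ (Φ y s t)
        ≡⟨ leafPairing-shape (λ _ → 1ℤ) (P y) (χ (P y)) s t u x̂ ⟩
      ψ (P y) - χ (P y) * ψ u + s * ψ u + t * ψ x̂
        ≡⟨ cong₂ (λ p q → p - χ (P y) * ψ u + s * ψ u + t * q)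
                 (trans (ψ-P y) (cong (_+ (+ ℓ - 1ℤ) * r₀ * y center) ⟨r,y⟩≡0)) ψ-x̂ ⟩
      (0ℤ + (+ ℓ - 1ℤ) * r₀ * y center) - χ (P y) * ψ u + s * ψ u
        + t * (1ℤ - χ ξ * (+ d center * r₀))
        ≡⟨ cong (λ p → (0ℤ + (+ ℓ - 1ℤ) * r₀ * y center) - χ (P y) * p + s * p
                       + t * (1ℤ - χ ξ * (+ d center * r₀))) ψ-u ⟩
      (0ℤ + (+ ℓ - 1ℤ) * r₀ * y center) - χ (P y) * (+ d center * r₀) + s * (+ d center * r₀)
        + t * (1ℤ - χ ξ * (+ d center * r₀))
        ≡⟨ collect (+ ℓ - 1ℤ) (y center) (χ (P y)) s t (χ ξ) (+ d center) r₀ ⟩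
      t + r₀ * ((+ ℓ - 1ℤ) * y center - (χ (P y) - s + t * χ ξ) * + d center) ∎
      where
      open ≡-Reasoning
      collect : ∀ L yc X s t Y D r →
        (0ℤ + L * r * yc) - X * (D * r) + s * (D * r) + t * (1ℤ - Y * (D * r))
        ≡ t + r * (L * yc - (X - s + t * Y) * D)
      collect = solve-∀

    private
      multiple-of-r₀ : ∀ x {A B} → r₀ * A ≡ x + r₀ * B → Σ ℤ λ σ → x ≡ σ * r₀
      multiple-of-r₀ x {A} {B} r₀A≡x+r₀B = A - B , (begin
        x                       ≡⟨ isolate x r₀ B ⟩
        x + r₀ * B - r₀ * B     ≡⟨ cong (_- r₀ * B) (sym r₀A≡x+r₀B) ⟩
        r₀ * A - r₀ * B         ≡⟨ factor r₀ A B ⟩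
        (A - B) * r₀            ∎)
        where
        open ≡-Reasoning
        isolate : ∀ x r B → x ≡ x + r * B - r * B
        isolate = solve-∀
        factor : ∀ r A B → r * A - r * B ≡ (A - B) * r
        factor = solve-∀

    Φ-divisible⇒r₀∣s : ∀ y s t (q : Fin ℓ → ℤ) → (∀ i → Φ y s t i ≡ q i * dStarℤ i) →
      Σ ℤ λ σ → s ≡ σ * r₀
    Φ-divisible⇒r₀∣s y s t q Φ≡qd* =
      multiple-of-r₀ s (trans (sym (leafPairing-dStar c q (Φ y s t) Φ≡qd*)) (χ-Φ y s t))

    Φ-divisible⇒r₀∣t : ∀ y s t (q : Fin ℓ → ℤ) → ⟨ rℤ , y ⟩ ≡ 0ℤ →
      (∀ i → Φ y s t i ≡ q i * dStarℤ i) → Σ ℤ λ τ → t ≡ τ * r₀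
    Φ-divisible⇒r₀∣t y s t q ⟨r,y⟩≡0 Φ≡qd* =
      multiple-of-r₀ t (trans (sym (leafPairing-dStar (λ _ → 1ℤ) q (Φ y s t) Φ≡qd*))
                              (ψ-Φ y s t ⟨r,y⟩≡0))

    Φ-divisible⇒inImage : ∀ y s t (q : Fin ℓ → ℤ) → ⟨ rℤ , y ⟩ ≡ 0ℤ →
      (∀ i → Φ y s t i ≡ q i * dStarℤ i) → ∀ σ τ → s ≡ σ * r₀ → t ≡ τ * r₀ → InImage d y
    Φ-divisible⇒inImage y s t q ⟨r,y⟩≡0 Φ≡qd* σ τ s≡σr₀ t≡τr₀ =
      inImage-if-P≡u-mod-dStar y (χ (P y)) q′ ⟨r,y⟩≡0 Py≡
      where
      open ≡-Reasoning
      X : ℤ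
      X = χ (P y)
      q′ : Fin ℓ → ℤ
      q′ i = q i - σ * + rLeaf i * u i - τ * + rLeaf i * x̂ i
      Py≡ : ∀ i → P y i ≡ X * u i + q′ i * dStarℤ i
      Py≡ i = begin
        P y i
          ≡⟨ unfold (P y i) X (u i) s t (x̂ i) ⟩
        Φ y s t i + X * u i - (s * u i + t * x̂ i)
          ≡⟨ cong₂ (λ F p → F + X * u i - p)
                   (Φ≡qd* i) (cong₂ (λ s′ t′ → s′ * u i + t′ * x̂ i) s≡σr₀ t≡τr₀) ⟩
        q i * dStarℤ i + X * u i - (σ * r₀ * u i + τ * r₀ * x̂ i)
          ≡⟨ cong (λ r → q i * dStarℤ i + X * u i - (σ * r * u i + τ * r * x̂ i))
                  (sym (rLeaf*dStar i)) ⟩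
        q i * dStarℤ i + X * u i - (σ * (+ rLeaf i * dStarℤ i) * u i + τ * (+ rLeaf i * dStarℤ i) * x̂ i)
          ≡⟨ collect (q i) (dStarℤ i) X (u i) σ τ (+ rLeaf i) (x̂ i) ⟩
        X * u i + q′ i * dStarℤ i ∎
        where
        unfold : ∀ p X u s t x → p ≡ (p - X * u + s * u + t * x) + X * u - (s * u + t * x)
        unfold = solve-∀
        collect : ∀ q D X u σ τ R x →
          q * D + X * u - (σ * (R * D) * u + τ * (R * D) * x) ≡ X * u + (q - σ * R * u - τ * R * x) * D
        collect = solve-∀

    leafPart : (Fin ℓ → ℤ) → Fin ℓ → ℤ
    leafPart z i = z i - χ z * u i + 0ℤ * u i + (- ψ z) * x̂ i

    centerPart : (Fin ℓ → ℤ) → ℤ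
    centerPart z = ψ z * χ ξ * + d center - χ z * + d center

    ψ-leafPart : ∀ z → ψ (leafPart z) ≡ r₀ * centerPart z
    ψ-leafPart z = begin
      ψ (leafPart z)
        ≡⟨ leafPairing-shape (λ _ → 1ℤ) z s 0ℤ (- t) u x̂ ⟩
      t - s * ψ u + 0ℤ * ψ u + (- t) * ψ x̂
        ≡⟨ cong₂ (λ p x → t - s * p + 0ℤ * p + (- t) * x) ψ-u ψ-x̂ ⟩
      t - s * (+ d center * r₀) + 0ℤ * (+ d center * r₀) + (- t) * (1ℤ - χ ξ * (+ d center * r₀))
        ≡⟨ collect t s r₀ (+ d center) (χ ξ) ⟩
      r₀ * centerPart z ∎
      where
      open ≡-Reasoning
      s t : ℤ
      s = χ z
      t = ψ z
      collect : ∀ t s r D Y →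
        t - s * (D * r) + 0ℤ * (D * r) + (- t) * (1ℤ - Y * (D * r)) ≡ r * (t * Y * D - s * D)
      collect = solve-∀

    χ-leafPart : ∀ z → χ (leafPart z) ≡ r₀ * (χ z * c₀ - ψ z * χ ξ * c₀)
    χ-leafPart z = begin
      χ (leafPart z)
        ≡⟨ leafPairing-shape c z s 0ℤ (- t) u x̂ ⟩
      s - s * χ u + 0ℤ * χ u + (- t) * χ x̂
        ≡⟨ cong₂ (λ p x → s - s * p + 0ℤ * p + (- t) * x) χ-u χ-x̂ ⟩
      s - s * (1ℤ - c₀ * r₀) + 0ℤ * (1ℤ - c₀ * r₀) + (- t) * (χ ξ - χ ξ * (1ℤ - c₀ * r₀))
        ≡⟨ collect s t c₀ r₀ (χ ξ) ⟩
      r₀ * (s * c₀ - t * χ ξ * c₀) ∎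
      where
      open ≡-Reasoning
      s t : ℤ
      s = χ z
      t = ψ z
      collect : ∀ s t c₀ r Y →
        s - s * (1ℤ - c₀ * r) + 0ℤ * (1ℤ - c₀ * r) + (- t) * (Y - Y * (1ℤ - c₀ * r))
        ≡ r * (s * c₀ - t * Y * c₀)
      collect = solve-∀

    preimage : (Fin ℓ → ℤ) → V → ℤ
    preimage z v = atLeaves (leafPart z) v - centerPart z * eCenter v

    preimage-torsion : ∀ z → IsTorsion d (preimage z)
    preimage-torsion z =
      ℕ.pred (r center) ,
      subst (λ n → InImage d (λ v → + n * preimage z v)) (sym (ℕ.suc-pred (r center) {{r≢0 center}}))
            (r₀-multiple-inImage (leafPart z) (centerPart z) (ψ-leafPart z))

    χ-P-preimage : ∀ z →
      χ (P (preimage z)) ≡ r₀ * (χ z * c₀ - ψ z * χ ξ * c₀) - centerPart z * (r₀ * ∑ ℓ c)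
    χ-P-preimage z = begin
      χ (P (preimage z))
        ≡⟨ leafPairing-cong c (λ i → trans (P-atLeaves w₀ q i) (asCombination (w₀ i) q (dStarℤ i))) ⟩
      χ (λ i → 1ℤ * w₀ i + (- q) * dStarℤ i)
        ≡⟨ leafPairing-linear c 1ℤ w₀ (- q) dStarℤ ⟩
      1ℤ * χ w₀ + (- q) * χ dStarℤ
        ≡⟨ cong₂ (λ a b → 1ℤ * a + (- q) * b) (χ-leafPart z) χ-dStar ⟩
      1ℤ * (r₀ * (χ z * c₀ - ψ z * χ ξ * c₀)) + (- q) * (r₀ * ∑ ℓ c)
        ≡⟨ sym (asCombination (r₀ * (χ z * c₀ - ψ z * χ ξ * c₀)) q (r₀ * ∑ ℓ c)) ⟩
      r₀ * (χ z * c₀ - ψ z * χ ξ * c₀) - q * (r₀ * ∑ ℓ c) ∎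
      where
      open ≡-Reasoning
      w₀ : Fin ℓ → ℤ
      w₀ = leafPart z
      q : ℤ
      q = centerPart z
      asCombination : ∀ a q b → a - q * b ≡ 1ℤ * a + (- q) * b
      asCombination = solve-∀

    Φ-preimage : ∀ z i → Σ ℤ λ Q → Φ (preimage z) (χ z) (ψ z) i - z i ≡ Q * dStarℤ i
    Φ-preimage z i = Q , (begin
      Φ (preimage z) s t i - z i
        ≡⟨ cong₂ (λ p x → p - x * u i + s * u i + t * x̂ i - z i) (P-atLeaves w₀ q i) (χ-P-preimage z) ⟩
      G r₀
        ≡⟨ cong G (sym (rLeaf*dStar i)) ⟩
      G (+ rLeaf i * dStarℤ i)
        ≡⟨ collect (+ rLeaf i) (dStarℤ i) (z i) s (u i) t (x̂ i) q c₀ (χ ξ) (∑ ℓ c) ⟩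
      Q * dStarℤ i ∎)
      where
      open ≡-Reasoning
      s t q : ℤ
      s = χ z
      t = ψ z
      q = centerPart z
      w₀ : Fin ℓ → ℤ
      w₀ = leafPart z
      Q : ℤ
      Q = (- q) - (s * c₀ - t * χ ξ * c₀) * + rLeaf i * u i + q * + rLeaf i * ∑ ℓ c * u i
      G : ℤ → ℤ
      G r = (w₀ i - q * dStarℤ i) - (r * (s * c₀ - t * χ ξ * c₀) - q * (r * ∑ ℓ c)) * u i
            + s * u i + t * x̂ i - z i
      collect : ∀ R D z s u t x q c₀ Y C →
        ((z - s * u + 0ℤ * u + (- t) * x) - q * D)
          - ((R * D) * (s * c₀ - t * Y * c₀) - q * ((R * D) * C)) * u + s * u + t * x - z
        ≡ ((- q) - (s * c₀ - t * Y * c₀) * R * u + q * R * C * u) * D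
      collect = solve-∀

    private
      K⊕ℤ/r₀² ⨁ℤ/d* : RawGroup 0ℓ 0ℓ
      K⊕ℤ/r₀² = rawGroup (criticalGroup d) (rawGroup (ℤmod (r center)) (ℤmod (r center)))
      ⨁ℤ/d* = ⨁ℤmod ℓ (dStar r r≢0)

      open RawGroup K⊕ℤ/r₀² using () renaming (Carrier to G; _≈_ to _≈ᴳ_)
      open RawGroup ⨁ℤ/d* using () renaming (Carrier to H; _≈_ to _≈ᴴ_)

    isoMap : G → H
    isoMap ((y , _) , (s , t)) = Φ y s t

    isoMap-respects-Lap : ∀ y y′ s s′ t′ t a → (∀ v → y v - y′ v ≡ Lap d a v) →
      r₀ ∣ℤ (s - s′) → r₀ ∣ℤ (t - t′) →
      ∀ i → Σ ℤ λ Q → Φ y s t i - Φ y′ s′ t′ i ≡ Q * dStarℤ i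
    isoMap-respects-Lap y y′ s s′ t′ t a y-y′≡Lap-a r₀∣s-s′ r₀∣t-t′ i
      with ∣ℤ-elim r₀ (s - s′) r₀∣s-s′ | ∣ℤ-elim r₀ (t - t′) r₀∣t-t′
    ... | σ , s-s′≡σr₀ | τ , t-t′≡τr₀ =
      proj₁ (Φ-Lap a σ τ i) ,
      trans (sym (Φ-sub y y′ s s′ t t′ i))
            (trans (Φ-cong i y-y′≡Lap-a s-s′≡σr₀ t-t′≡τr₀) (proj₂ (Φ-Lap a σ τ i)))

    isoMap-cong : ∀ {x x′} → x ≈ᴳ x′ → isoMap x ≈ᴴ isoMap x′
    isoMap-cong {(y , _) , (s , t)} {(y′ , _) , (s′ , t′)}
                ((a , y-y′≡Lap-a) , r₀∣s-s′ , r₀∣t-t′) i =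
      ∣ℤ-intro (dStarℤ i) (Φ y s t i - Φ y′ s′ t′ i) (proj₁ respects) (proj₂ respects)
      where
      respects : Σ ℤ λ Q → Φ y s t i - Φ y′ s′ t′ i ≡ Q * dStarℤ i
      respects = isoMap-respects-Lap y y′ s s′ t′ t a y-y′≡Lap-a r₀∣s-s′ r₀∣t-t′ i

    isoMap-injective : ∀ {x x′} → isoMap x ≈ᴴ isoMap x′ → x ≈ᴳ x′
    isoMap-injective {(y , torsion-y) , (s , t)} {(y′ , torsion-y′) , (s′ , t′)} Φ≈Φ′ =
      Φ-divisible⇒inImage yd (s - s′) (t - t′) q ⟨r,yd⟩≡0 Φ≡qd* σ τ s-s′≡σr₀ t-t′≡τr₀ ,
      ∣ℤ-intro r₀ (s - s′) σ s-s′≡σr₀ ,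
      ∣ℤ-intro r₀ (t - t′) τ t-t′≡τr₀
      where
      yd : V → ℤ
      yd v = y v - y′ v
      quotient : ∀ i → Σ ℤ λ Q → Φ y s t i - Φ y′ s′ t′ i ≡ Q * dStarℤ i
      quotient i = ∣ℤ-elim (dStarℤ i) (Φ y s t i - Φ y′ s′ t′ i) (Φ≈Φ′ i)
      q : Fin ℓ → ℤ
      q i = proj₁ (quotient i)
      Φ≡qd* : ∀ i → Φ yd (s - s′) (t - t′) i ≡ q i * dStarℤ i
      Φ≡qd* i = trans (Φ-sub y y′ s s′ t t′ i) (proj₂ (quotient i))
      ⟨r,yd⟩≡0 : ⟨ rℤ , yd ⟩ ≡ 0ℤ
      ⟨r,yd⟩≡0 = trans (⟨⟩-subʳ rℤ y y′)
                       (cong₂ _-_ (⟨r,torsion⟩≡0 y torsion-y) (⟨r,torsion⟩≡0 y′ torsion-y′))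
      σ τ : ℤ
      σ = proj₁ (Φ-divisible⇒r₀∣s yd (s - s′) (t - t′) q Φ≡qd*)
      τ = proj₁ (Φ-divisible⇒r₀∣t yd (s - s′) (t - t′) q ⟨r,yd⟩≡0 Φ≡qd*)
      s-s′≡σr₀ : s - s′ ≡ σ * r₀
      s-s′≡σr₀ = proj₂ (Φ-divisible⇒r₀∣s yd (s - s′) (t - t′) q Φ≡qd*)
      t-t′≡τr₀ : t - t′ ≡ τ * r₀
      t-t′≡τr₀ = proj₂ (Φ-divisible⇒r₀∣t yd (s - s′) (t - t′) q ⟨r,yd⟩≡0 Φ≡qd*)

    isoMap-surjective : ∀ z → Σ G λ x → ∀ {x′} → x′ ≈ᴳ x → isoMap x′ ≈ᴴ z
    isoMap-surjective z = ((y , preimage-torsion z) , (s , t)) , λ {x′} → close {x′}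
      where
      y : V → ℤ
      y = preimage z
      s t : ℤ
      s = χ z
      t = ψ z
      close : ∀ {x′} → x′ ≈ᴳ ((y , preimage-torsion z) , (s , t)) → isoMap x′ ≈ᴴ z
      close {(y′ , _) , (s′ , t′)} ((a , y′-y≡Lap-a) , r₀∣s′-s , r₀∣t′-t) i =
        ∣ℤ-intro (dStarℤ i) (Φ y′ s′ t′ i - z i) (Q₁ + Q₂) (begin
          Φ y′ s′ t′ i - z i
            ≡⟨ split (Φ y′ s′ t′ i) (Φ y s t i) (z i) ⟩
          (Φ y′ s′ t′ i - Φ y s t i) + (Φ y s t i - z i)
            ≡⟨ cong₂ _+_ e₁ e₂ ⟩
          Q₁ * dStarℤ i + Q₂ * dStarℤ i
            ≡⟨ sym (ℤ.*-distribʳ-+ (dStarℤ i) Q₁ Q₂) ⟩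
          (Q₁ + Q₂) * dStarℤ i ∎)
        where
        open ≡-Reasoning
        respects : Σ ℤ λ Q → Φ y′ s′ t′ i - Φ y s t i ≡ Q * dStarℤ i
        respects = isoMap-respects-Lap y′ y s′ s t t′ a y′-y≡Lap-a r₀∣s′-s r₀∣t′-t i
        Q₁ Q₂ : ℤ
        Q₁ = proj₁ respects
        Q₂ = proj₁ (Φ-preimage z i)
        e₁ : Φ y′ s′ t′ i - Φ y s t i ≡ Q₁ * dStarℤ i
        e₁ = proj₂ respects
        e₂ : Φ y s t i - z i ≡ Q₂ * dStarℤ i
        e₂ = proj₂ (Φ-preimage z i)
        split : ∀ a b c → a - c ≡ (a - b) + (b - c)
        split = solve-∀

    ≡⇒≈ᴴ : ∀ {z z′ : H} → (∀ i → z i ≡ z′ i) → z ≈ᴴ z′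
    ≡⇒≈ᴴ {z} {z′} z≡z′ i = ∣ℤ-intro (dStarℤ i) (z i - z′ i) 0ℤ (ℤ.i≡j⇒i-j≡0 (z≡z′ i))

    isoMap-isIsomorphism : IsGroupIsomorphism K⊕ℤ/r₀² ⨁ℤ/d* isoMap
    isoMap-isIsomorphism = record
      { isGroupMonomorphism = record
        { isGroupHomomorphism = record
          { isMonoidHomomorphism = record
            { isMagmaHomomorphism = record
              { isRelHomomorphism = record { cong = λ {x} {x′} → isoMap-cong {x} {x′} }
              ; homo = λ { ((y , _) , (s , t)) ((y′ , _) , (s′ , t′)) →
                             ≡⇒≈ᴴ (Φ-+ y y′ s s′ t t′) }
              }
            ; ε-homo = ≡⇒≈ᴴ Φ-zero
            }
          ; ⁻¹-homo = λ { ((y , _) , (s , t)) → ≡⇒≈ᴴ (Φ-neg y s t) }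
          }
        ; injective = λ {x} {x′} → isoMap-injective {x} {x′}
        }
      ; surjective = isoMap-surjective
      }

theorem6p4 : (ℓ : ℕ) (k : Fin ℓ → ℕ) → 3 ≤ ℓ →
    (d r : Vtx ℓ k → ℕ) → (as : IsArithmeticalStructure d r) →
    rawGroup (criticalGroup d) (rawGroup (ℤmod (r center)) (ℤmod (r center)))
      ≅ ⨁ℤmod ℓ (dStar r (proj₁ as))
theorem6p4 (suc ℓ) k _ d r as = isoMap d r as zero , isoMap-isIsomorphism d r as zero
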